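{- Let $v$ be a positive integer and let $\mathcal{D}$ be a binary $q$-Steiner triple system $S_2[2,3,v]$, i.e. a set of $3$-dimensional subspaces of $\mathbb{F}_2^v$ such that every $2$-dimensional subspace of $\mathbb{F}_2^v$ is contained in exactly one member of $\mathcal{D}$. Let $A\in\mathrm{GL}(v,2)$ be (the matrix of) an automorphism of $\mathcal{D}$ of order $2$. For $s\in\{1,\ldots,\lfloor v/2\rfloor\}$ let $A_{v,s}$ denote the $v\times v$ block diagonal matrix built from $s$ blocks $\begin{pmatrix}0&1\\1&0\end{pmatrix}$ followed by a $(v-2s)\times(v-2s)$ identity matrix. (a) If $v\equiv 1\pmod 6$, then $A$ is conjugate in $\mathrm{GL}(v,2)$ to a matrix $A_{v,s}$ with $3\mid s$. (b) If $v\equiv 3\pmod 6$, then $A$ is conjugate in $\mathrm{GL}(v,2)$ to a matrix $A_{v,s}$ with $s\not\equiv 2\pmod 3$.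
   Context: Vectors are row vectors; $A\in\mathrm{GL}(v,2)$ acts on subspaces by $U\mapsto UA=\{\mathbf{u}A:\mathbf{u}\in U\}$ and on sets of subspaces elementwise. $A$ is an automorphism of $\mathcal{D}$ if $\{BA: B\in\mathcal{D}\}=\mathcal{D}$. -}

module Defs where

open import Data.Bool using (Bool; true; false; _∧_; _xor_; not; if_then_else_)
open import Data.Nat using (ℕ; zero; suc; _<ᵇ_; _≡ᵇ_; _*_; _/_)
open import Data.Fin using (Fin; toℕ)
open import Data.Vec using (Vec; []; _∷_; replicate; zipWith; foldr; map; tabulate)
open import Data.Product using (Σ; _×_; _,_)
open import Relation.Binary.PropositionalEquality using (_≡_)

-- The field F₂ is Bool with _xor_ as addition and _∧_ as multiplication.
F₂ : Set
F₂ = Bool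

Vecᶠ : ℕ → Set
Vecᶠ v = Vec F₂ v

zeroV : ∀ {v} → Vecᶠ v
zeroV = replicate _ false

_⊕_ : ∀ {v} → Vecᶠ v → Vecᶠ v → Vecᶠ v
_⊕_ = zipWith _xor_

scale : ∀ {v} → F₂ → Vecᶠ v → Vecᶠ v
scale c = map (c ∧_)

-- v × v matrices over F₂, given as a vector of rows.
Mat : ℕ → Set
Mat v = Vec (Vecᶠ v) v

_·ᵥ_ : ∀ {k v} → Vec F₂ k → Vec (Vecᶠ v) k → Vecᶠ v
[] ·ᵥ [] = zeroV
(c ∷ u) ·ᵥ (r ∷ A) = scale c r ⊕ (u ·ᵥ A)

_·ₘ_ : ∀ {v} → Mat v → Mat v → Mat v
A ·ₘ B = map (_·ᵥ B) A

idMat : ∀ {v} → Mat v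
idMat = tabulate λ i → tabulate λ j → toℕ i ≡ᵇ toℕ j

Invertible : ∀ {v} → Mat v → Set
Invertible {v} A = Σ (Mat v) λ B → (A ·ₘ B ≡ idMat) × (B ·ₘ A ≡ idMat)

HasOrder2 : ∀ {v} → Mat v → Set
HasOrder2 A = (A ·ₘ A ≡ idMat) × (A ≡ idMat → Data.Empty.⊥)
  where import Data.Empty

Conjugate : ∀ {v} → Mat v → Mat v → Set
Conjugate {v} A B =
  Σ (Mat v) λ P → Σ (Mat v) λ Q →
    (P ·ₘ Q ≡ idMat) × (Q ·ₘ P ≡ idMat) × ((Q ·ₘ A) ·ₘ P ≡ B)

Avs : (v s : ℕ) → Mat v
Avs v s = tabulate λ i → tabulate λ j → entry (toℕ i) (toℕ j)
  where
  entry : ℕ → ℕ → Bool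
  entry i j = if i <ᵇ (2 * s)
              then ((j <ᵇ (2 * s)) ∧ ((i / 2) ≡ᵇ (j / 2)) ∧ not (i ≡ᵇ j))
              else (i ≡ᵇ j)

Sub : ℕ → Set₁
Sub v = Vecᶠ v → Set

_⊆_ : ∀ {v} → Sub v → Sub v → Set
U ⊆ W = ∀ x → U x → W x

_≐_ : ∀ {v} → Sub v → Sub v → Set
U ≐ W = (U ⊆ W) × (W ⊆ U)

_·ˢ_ : ∀ {v} → Sub v → Mat v → Sub v
(U ·ˢ A) x = Σ _ λ u → U u × (u ·ᵥ A ≡ x)

lincomb : ∀ {v k} → Vec F₂ k → Vec (Vecᶠ v) k → Vecᶠ v
lincomb [] [] = zeroV
lincomb (c ∷ cs) (b ∷ bs) = scale c b ⊕ lincomb cs bs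

span : ∀ {v k} → Vec (Vecᶠ v) k → Sub v
span {v} {k} b x = Σ (Vec F₂ k) λ c → lincomb c b ≡ x

LinIndep : ∀ {v k} → Vec (Vecᶠ v) k → Set
LinIndep {v} {k} b = ∀ (c : Vec F₂ k) → lincomb c b ≡ zeroV → c ≡ replicate k false

IsSubspaceDim : ∀ {v} → ℕ → Sub v → Set
IsSubspaceDim {v} k U = Σ (Vec (Vecᶠ v) k) λ b → LinIndep b × (U ≐ span b)

-- Sets of subspaces. A set of subspaces is given by a family
-- 𝒟 : Sub v → Set; membership is taken up to equality of subspaces.

SetOfSub : ℕ → Set₂
SetOfSub v = Sub v → Set₁

_∈ᴰ_ : ∀ {v} → Sub v → SetOfSub v → Set₁
B ∈ᴰ 𝒟 = Σ _ λ B' → 𝒟 B' × (B' ≐ B)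

IsSTS : ∀ {v} → SetOfSub v → Set₁
IsSTS {v} 𝒟 =
  (∀ B → B ∈ᴰ 𝒟 → IsSubspaceDim 3 B) ×
  (∀ (T : Sub v) → IsSubspaceDim 2 T →
      Σ (Sub v) (λ B → B ∈ᴰ 𝒟 × (T ⊆ B)) ×
      (∀ B B' → B ∈ᴰ 𝒟 → T ⊆ B → B' ∈ᴰ 𝒟 → T ⊆ B' → B ≐ B'))

IsAutomorphism : ∀ {v} → SetOfSub v → Mat v → Set₁
IsAutomorphism {v} 𝒟 A =
  (∀ B → B ∈ᴰ 𝒟 → (B ·ˢ A) ∈ᴰ 𝒟) ×
  (∀ C → C ∈ᴰ 𝒟 → Σ (Sub v) λ B → B ∈ᴰ 𝒟 × ((B ·ˢ A) ≐ C))

-- An involution A ≠ I of F₂^v is conjugate to A_{v,s}, where s is the rank of A + I, and its fixed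
-- space has dimension f = v − s. Count the triples (p, q, r) with p ≠ q nonzero fixed vectors and r in
-- the block through p and q but outside ⟨p, q⟩: there are 4k(k − 1) of them, k = 2^f − 1. When r is
-- moved, the block through r and r A is A-invariant and contains exactly three nonzero fixed vectors,
-- so these triples number 6(2^v − 2^f). The triples with r fixed are permuted without fixed points by
-- (p, q, r) ↦ (q, r, p + q), which has order 7, so 7 divides their number. Since 2^n mod 7 depends only
-- on n mod 3, the resulting congruence 4k(k − 1) ≡ 6(2^v − 2^f) (mod 7) leaves only s ≡ 0 with
-- f ≢ 2, or s ≡ 1 with f ≡ 2 (mod 3); with v = s + f this gives both statements.

module Submission where

open import Defs
open import Data.Bool using (Bool; true; false; _∧_; _∨_; _xor_; not; if_then_else_)
open import Data.Bool.Properties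
  using (xor-assoc; xor-comm; xor-same; xor-identityˡ; xor-identityʳ; ∧-zeroʳ; ∧-identityʳ; ∨-zeroʳ; T-≡)
open import Data.Empty using (⊥; ⊥-elim)
open import Data.Fin using (Fin; toℕ)
import Data.Fin as Fin
open import Data.Nat using (ℕ; zero; suc; _+_; _*_; _∸_; _^_; _≤_; _<_; z≤n; s≤s; _%_; _/_; _<ᵇ_; _≡ᵇ_; _≤?_)
open import Data.Nat.Properties
open import Algebra.Properties.CommutativeSemigroup +-commutativeSemigroup using () renaming (interchange to +-interchange)
open import Data.Nat.DivMod
  using (m/n≡1+[m∸n]/n; m∣n⇒o%n%m≡o%m; m*n/n≡m; /-mono-≤; %-distribˡ-+; %-distribˡ-*; m%n%n≡m%n;
         [m+kn]%n≡m%n; [m+n]%n≡m%n; %-remove-+ˡ; m%n<n)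
open import Data.Nat.Divisibility using (_∣_; divides; ∣-refl; ∣m∣n⇒∣m+n; m%n≡0⇒n∣m)
open import Data.Nat.GeneralisedArithmetic using (fold; fold-+)
open import Data.Nat.Tactic.RingSolver using (solve-∀)
open import Data.Product using (Σ; _×_; _,_; proj₁; proj₂)
open import Data.Sum using (_⊎_; inj₁; inj₂)
open import Data.Vec using (Vec; []; _∷_; replicate; zipWith; map; tabulate; lookup; _++_; splitAt)
open import Data.Vec.Properties
  using (zipWith-assoc; zipWith-comm; zipWith-identityˡ; zipWith-identityʳ; map-cong; map-∘; map-id;
         lookup∘tabulate; tabulate∘lookup; tabulate-cong; tabulate-∘; ++-injective; ∷-injective)
open import Function.Bundles using (Equivalence)
open import Relation.Binary.PropositionalEquality
open import Relation.Nullary using (yes; no)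

∧-elimˡ : ∀ a {b} → a ∧ b ≡ true → a ≡ true
∧-elimˡ true _ = refl

∧-elimʳ : ∀ a {b} → a ∧ b ≡ true → b ≡ true
∧-elimʳ true e = e

∧-intro : ∀ {a b} → a ≡ true → b ≡ true → a ∧ b ≡ true
∧-intro refl refl = refl

false≢true : false ≡ true → ⊥
false≢true ()

not-true : ∀ b → not b ≡ true → b ≡ false
not-true false _ = refl

not-false : ∀ b → not b ≡ false → b ≡ true
not-false true _ = refl

≡true-ext : ∀ (a b : Bool) → (a ≡ true → b ≡ true) → (b ≡ true → a ≡ true) → a ≡ b
≡true-ext true true _ _ = refl
≡true-ext true false h _ = sym (h refl)
≡true-ext false true _ h = h refl
≡true-ext false false _ _ = refl

-- Vectors and matrices over F₂

⊕-assoc : ∀ {n} (x y z : Vecᶠ n) → (x ⊕ y) ⊕ z ≡ x ⊕ (y ⊕ z)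
⊕-assoc = zipWith-assoc xor-assoc

⊕-comm : ∀ {n} (x y : Vecᶠ n) → x ⊕ y ≡ y ⊕ x
⊕-comm = zipWith-comm xor-comm

⊕-identityˡ : ∀ {n} (x : Vecᶠ n) → zeroV ⊕ x ≡ x
⊕-identityˡ = zipWith-identityˡ xor-identityˡ

⊕-identityʳ : ∀ {n} (x : Vecᶠ n) → x ⊕ zeroV ≡ x
⊕-identityʳ = zipWith-identityʳ xor-identityʳ

⊕-same : ∀ {n} (x : Vecᶠ n) → x ⊕ x ≡ zeroV
⊕-same [] = refl
⊕-same (a ∷ x) = cong₂ _∷_ (xor-same a) (⊕-same x)

⊕-cancelʳ : ∀ {n} (x y : Vecᶠ n) → (y ⊕ x) ⊕ x ≡ y
⊕-cancelʳ x y = trans (⊕-assoc y x x) (trans (cong (y ⊕_) (⊕-same x)) (⊕-identityʳ y))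

⊕≡0⇒≡ : ∀ {n} (x y : Vecᶠ n) → x ⊕ y ≡ zeroV → x ≡ y
⊕≡0⇒≡ x y eq = trans (sym (⊕-cancelʳ y x)) (trans (cong (_⊕ y) eq) (⊕-identityˡ y))

≡⇒⊕≡0 : ∀ {n} {x y : Vecᶠ n} → x ≡ y → x ⊕ y ≡ zeroV
≡⇒⊕≡0 {x = x} refl = ⊕-same x

⊕-interchange : ∀ {n} (a b c d : Vecᶠ n) → (a ⊕ b) ⊕ (c ⊕ d) ≡ (a ⊕ c) ⊕ (b ⊕ d)
⊕-interchange a b c d = begin
  (a ⊕ b) ⊕ (c ⊕ d) ≡⟨ ⊕-assoc a b (c ⊕ d) ⟩
  a ⊕ (b ⊕ (c ⊕ d)) ≡⟨ cong (a ⊕_) (sym (⊕-assoc b c d)) ⟩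
  a ⊕ ((b ⊕ c) ⊕ d) ≡⟨ cong (λ t → a ⊕ (t ⊕ d)) (⊕-comm b c) ⟩
  a ⊕ ((c ⊕ b) ⊕ d) ≡⟨ cong (a ⊕_) (⊕-assoc c b d) ⟩
  a ⊕ (c ⊕ (b ⊕ d)) ≡⟨ sym (⊕-assoc a c (b ⊕ d)) ⟩
  (a ⊕ c) ⊕ (b ⊕ d) ∎
  where open ≡-Reasoning

scale-true : ∀ {n} (x : Vecᶠ n) → scale true x ≡ x
scale-true [] = refl
scale-true (a ∷ x) = cong (a ∷_) (scale-true x)

scale-false : ∀ {n} (x : Vecᶠ n) → scale false x ≡ zeroV
scale-false [] = refl
scale-false (a ∷ x) = cong (false ∷_) (scale-false x)

scale-zeroV : ∀ {n} c → scale c (zeroV {n}) ≡ zeroV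
scale-zeroV true = scale-true zeroV
scale-zeroV false = scale-false zeroV

scale-distribˡ-⊕ : ∀ {n} c (x y : Vecᶠ n) → scale c (x ⊕ y) ≡ scale c x ⊕ scale c y
scale-distribˡ-⊕ true x y = trans (scale-true _) (sym (cong₂ _⊕_ (scale-true x) (scale-true y)))
scale-distribˡ-⊕ false x y =
  trans (scale-false _) (sym (trans (cong₂ _⊕_ (scale-false x) (scale-false y)) (⊕-same zeroV)))

scale-distribʳ-xor : ∀ {n} a b (x : Vecᶠ n) → scale (a xor b) x ≡ scale a x ⊕ scale b x
scale-distribʳ-xor true true x = trans (scale-false x) (sym (trans (cong₂ _⊕_ (scale-true x) (scale-true x)) (⊕-same x)))
scale-distribʳ-xor true false x = trans (scale-true x) (sym (trans (cong₂ _⊕_ (scale-true x) (scale-false x)) (⊕-identityʳ x)))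
scale-distribʳ-xor false b x = sym (trans (cong (_⊕ scale b x) (scale-false x)) (⊕-identityˡ _))

·ᵥ-zeroˡ : ∀ {k n} (M : Vec (Vecᶠ n) k) → zeroV ·ᵥ M ≡ zeroV
·ᵥ-zeroˡ [] = refl
·ᵥ-zeroˡ (r ∷ M) = trans (cong₂ _⊕_ (scale-false r) (·ᵥ-zeroˡ M)) (⊕-same zeroV)

·ᵥ-zeroʳ : ∀ {k n} (c : Vecᶠ k) → c ·ᵥ replicate k (zeroV {n}) ≡ zeroV
·ᵥ-zeroʳ [] = refl
·ᵥ-zeroʳ (a ∷ c) = trans (cong₂ _⊕_ (scale-zeroV a) (·ᵥ-zeroʳ c)) (⊕-same zeroV)

·ᵥ-distribʳ-⊕ : ∀ {k n} (x y : Vecᶠ k) (M : Vec (Vecᶠ n) k) → (x ⊕ y) ·ᵥ M ≡ (x ·ᵥ M) ⊕ (y ·ᵥ M)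
·ᵥ-distribʳ-⊕ [] [] [] = sym (⊕-same zeroV)
·ᵥ-distribʳ-⊕ (a ∷ x) (b ∷ y) (r ∷ M) = begin
  scale (a xor b) r ⊕ ((x ⊕ y) ·ᵥ M)               ≡⟨ cong₂ _⊕_ (scale-distribʳ-xor a b r) (·ᵥ-distribʳ-⊕ x y M) ⟩
  (scale a r ⊕ scale b r) ⊕ ((x ·ᵥ M) ⊕ (y ·ᵥ M)) ≡⟨ ⊕-interchange _ _ _ _ ⟩
  (scale a r ⊕ (x ·ᵥ M)) ⊕ (scale b r ⊕ (y ·ᵥ M)) ∎
  where open ≡-Reasoning

·ᵥ-distribˡ-⊕ : ∀ {k n} (x : Vecᶠ k) (M N : Vec (Vecᶠ n) k) → x ·ᵥ zipWith _⊕_ M N ≡ (x ·ᵥ M) ⊕ (x ·ᵥ N)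
·ᵥ-distribˡ-⊕ [] [] [] = sym (⊕-same zeroV)
·ᵥ-distribˡ-⊕ (a ∷ x) (r ∷ M) (s ∷ N) = begin
  scale a (r ⊕ s) ⊕ (x ·ᵥ zipWith _⊕_ M N)         ≡⟨ cong₂ _⊕_ (scale-distribˡ-⊕ a r s) (·ᵥ-distribˡ-⊕ x M N) ⟩
  (scale a r ⊕ scale a s) ⊕ ((x ·ᵥ M) ⊕ (x ·ᵥ N)) ≡⟨ ⊕-interchange _ _ _ _ ⟩
  (scale a r ⊕ (x ·ᵥ M)) ⊕ (scale a s ⊕ (x ·ᵥ N)) ∎
  where open ≡-Reasoning

·ᵥ-scale : ∀ {k n} c (x : Vecᶠ k) (M : Vec (Vecᶠ n) k) → scale c x ·ᵥ M ≡ scale c (x ·ᵥ M)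
·ᵥ-scale true x M = trans (cong (_·ᵥ M) (scale-true x)) (sym (scale-true _))
·ᵥ-scale false x M = trans (cong (_·ᵥ M) (scale-false x)) (trans (·ᵥ-zeroˡ M) (sym (scale-false _)))

·ᵥ-assoc : ∀ {j k n} (x : Vecᶠ j) (M : Vec (Vecᶠ k) j) (N : Vec (Vecᶠ n) k) →
           x ·ᵥ map (_·ᵥ N) M ≡ (x ·ᵥ M) ·ᵥ N
·ᵥ-assoc [] [] N = sym (·ᵥ-zeroˡ N)
·ᵥ-assoc (a ∷ x) (r ∷ M) N = begin
  scale a (r ·ᵥ N) ⊕ (x ·ᵥ map (_·ᵥ N) M) ≡⟨ cong₂ _⊕_ (sym (·ᵥ-scale a r N)) (·ᵥ-assoc x M N) ⟩
  (scale a r ·ᵥ N) ⊕ ((x ·ᵥ M) ·ᵥ N)       ≡⟨ sym (·ᵥ-distribʳ-⊕ (scale a r) (x ·ᵥ M) N) ⟩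
  (scale a r ⊕ (x ·ᵥ M)) ·ᵥ N ∎
  where open ≡-Reasoning

·ₘ-assoc : ∀ {n} (A B C : Mat n) → (A ·ₘ B) ·ₘ C ≡ A ·ₘ (B ·ₘ C)
·ₘ-assoc A B C = trans (sym (map-∘ (_·ᵥ C) (_·ᵥ B) A)) (map-cong (λ x → sym (·ᵥ-assoc x B C)) A)

idMat-suc : ∀ {n} → idMat {suc n} ≡ (true ∷ zeroV) ∷ map (false ∷_) (idMat {n})
idMat-suc {n} = cong₂ _∷_ (cong (true ∷_) (firstRow n)) (tabulate-∘ (false ∷_) _)
  where
  firstRow : ∀ m → tabulate {m} (λ j → 0 ≡ᵇ suc (toℕ j)) ≡ zeroV
  firstRow zero = refl
  firstRow (suc m) = cong (false ∷_) (firstRow m)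

·ᵥ-false∷ : ∀ {k n} (x : Vecᶠ k) (M : Vec (Vecᶠ n) k) → x ·ᵥ map (false ∷_) M ≡ false ∷ (x ·ᵥ M)
·ᵥ-false∷ [] [] = refl
·ᵥ-false∷ (a ∷ x) (r ∷ M) rewrite ·ᵥ-false∷ x M = cong (_∷ (scale a r ⊕ (x ·ᵥ M))) (∧false-xor a)
  where
  ∧false-xor : ∀ a → (a ∧ false) xor false ≡ false
  ∧false-xor true = refl
  ∧false-xor false = refl

·ᵥ-identityʳ : ∀ {n} (x : Vecᶠ n) → x ·ᵥ idMat ≡ x
·ᵥ-identityʳ [] = refl
·ᵥ-identityʳ {suc n} (a ∷ x) = begin
  (a ∷ x) ·ᵥ idMat                                        ≡⟨ cong ((a ∷ x) ·ᵥ_) idMat-suc ⟩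
  scale a (true ∷ zeroV) ⊕ (x ·ᵥ map (false ∷_) idMat) ≡⟨ cong (scale a (true ∷ zeroV) ⊕_) (·ᵥ-false∷ x idMat) ⟩
  scale a (true ∷ zeroV) ⊕ (false ∷ (x ·ᵥ idMat))      ≡⟨ cong (λ t → scale a (true ∷ zeroV) ⊕ (false ∷ t)) (·ᵥ-identityʳ x) ⟩
  ((a ∧ true) xor false) ∷ (scale a zeroV ⊕ x)           ≡⟨ cong₂ _∷_ (∧true-xor a) (trans (cong (_⊕ x) (scale-zeroV a)) (⊕-identityˡ x)) ⟩
  a ∷ x ∎
  where
  open ≡-Reasoning
  ∧true-xor : ∀ a → (a ∧ true) xor false ≡ a
  ∧true-xor true = refl
  ∧true-xor false = refl

·ₘ-identityʳ : ∀ {n} (M : Mat n) → M ·ₘ idMat ≡ M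
·ₘ-identityʳ M = trans (map-cong ·ᵥ-identityʳ M) (map-id M)

idMat-·ᵥ : ∀ {k m} (M : Vec (Vecᶠ m) k) → map (_·ᵥ M) (idMat {k}) ≡ M
idMat-·ᵥ {zero} [] = refl
idMat-·ᵥ {suc k} (r ∷ M) = begin
  map (_·ᵥ (r ∷ M)) idMat                                        ≡⟨ cong (map (_·ᵥ (r ∷ M))) idMat-suc ⟩
  (true ∷ zeroV) ·ᵥ (r ∷ M) ∷ map (_·ᵥ (r ∷ M)) (map (false ∷_) idMat) ≡⟨ cong₂ _∷_ firstRow (sym (map-∘ _ _ idMat)) ⟩
  r ∷ map (λ x → (false ∷ x) ·ᵥ (r ∷ M)) idMat                  ≡⟨ cong (r ∷_) (map-cong falseRow idMat) ⟩
  r ∷ map (_·ᵥ M) idMat                                          ≡⟨ cong (r ∷_) (idMat-·ᵥ M) ⟩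
  r ∷ M ∎
  where
  open ≡-Reasoning
  firstRow : (true ∷ zeroV) ·ᵥ (r ∷ M) ≡ r
  firstRow = trans (cong₂ _⊕_ (scale-true r) (·ᵥ-zeroˡ M)) (⊕-identityʳ r)
  falseRow : ∀ x → (false ∷ x) ·ᵥ (r ∷ M) ≡ x ·ᵥ M
  falseRow x = trans (cong (_⊕ (x ·ᵥ M)) (scale-false r)) (⊕-identityˡ _)

lincomb≡·ᵥ : ∀ {k n} (c : Vecᶠ k) (b : Vec (Vecᶠ n) k) → lincomb c b ≡ c ·ᵥ b
lincomb≡·ᵥ [] [] = refl
lincomb≡·ᵥ (a ∷ c) (r ∷ b) = cong (scale a r ⊕_) (lincomb≡·ᵥ c b)

++-·ᵥ-++ : ∀ {k a b} (c : Vecᶠ a) (c' : Vecᶠ b) (P : Vec (Vecᶠ k) a) (Q : Vec (Vecᶠ k) b) →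
           (c ++ c') ·ᵥ (P ++ Q) ≡ (c ·ᵥ P) ⊕ (c' ·ᵥ Q)
++-·ᵥ-++ [] c' [] Q = sym (⊕-identityˡ _)
++-·ᵥ-++ (x ∷ c) c' (p ∷ P) Q = trans (cong (scale x p ⊕_) (++-·ᵥ-++ c c' P Q)) (sym (⊕-assoc _ _ _))

zeroV-++ : ∀ a b → zeroV {a + b} ≡ zeroV {a} ++ zeroV {b}
zeroV-++ zero b = refl
zeroV-++ (suc a) b = cong (false ∷_) (zeroV-++ a b)

++≡zeroV : ∀ {a b} (c : Vecᶠ a) (c' : Vecᶠ b) → c ++ c' ≡ zeroV → c ≡ zeroV × c' ≡ zeroV
++≡zeroV {a} {b} c c' eq = ++-injective c zeroV (trans eq (zeroV-++ a b))

-- Finite sums and counting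

𝟙 : Bool → ℕ
𝟙 true = 1
𝟙 false = 0

𝟙-split : ∀ b c → 𝟙 b ≡ 𝟙 (b ∧ c) + 𝟙 (b ∧ not c)
𝟙-split true true = refl
𝟙-split true false = refl
𝟙-split false c = refl

𝟙≤1 : ∀ b → 𝟙 b ≤ 1
𝟙≤1 true = ≤-refl
𝟙≤1 false = z≤n

record IsAdditive {Z : Set} (L : (Z → ℕ) → ℕ) : Set where
  field
    additive-cong : ∀ f g → (∀ z → f z ≡ g z) → L f ≡ L g
    additive-+ : ∀ f g → L (λ z → f z + g z) ≡ L f + L g
    additive-0 : L (λ _ → 0) ≡ 0

-- Finite types presented through their summation functional; sum-swap is Fubini's theorem.
record FinSet : Set₁ where
  field
    Carrier : Set
    _==_ : Carrier → Carrier → Bool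
    ==-sound : ∀ x y → x == y ≡ true → x ≡ y
    ==-refl : ∀ x → x == x ≡ true
    sum : (Carrier → ℕ) → ℕ
    sum-additive : IsAdditive sum
    sum-delta : ∀ x (f : Carrier → ℕ) → sum (λ y → if y == x then f y else 0) ≡ f x
    sum-witness : ∀ f → sum f ≢ 0 → Σ Carrier λ x → f x ≢ 0
    sum-swap : ∀ (Z : Set) (L : (Z → ℕ) → ℕ) → IsAdditive L → ∀ (f : Carrier → Z → ℕ) →
               sum (λ x → L (f x)) ≡ L (λ z → sum (λ x → f x z))
  open IsAdditive sum-additive public
    renaming (additive-cong to sum-cong; additive-+ to sum-+; additive-0 to sum-0)

_==ᵥ_ : ∀ {n} → Vecᶠ n → Vecᶠ n → Bool
[] ==ᵥ [] = true
(a ∷ x) ==ᵥ (b ∷ y) = (if a then b else not b) ∧ (x ==ᵥ y)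

==ᵥ-sound : ∀ {n} (x y : Vecᶠ n) → x ==ᵥ y ≡ true → x ≡ y
==ᵥ-sound [] [] _ = refl
==ᵥ-sound (true ∷ x) (true ∷ y) e = cong (true ∷_) (==ᵥ-sound x y e)
==ᵥ-sound (false ∷ x) (false ∷ y) e = cong (false ∷_) (==ᵥ-sound x y e)

==ᵥ-refl : ∀ {n} (x : Vecᶠ n) → x ==ᵥ x ≡ true
==ᵥ-refl [] = refl
==ᵥ-refl (true ∷ x) = ==ᵥ-refl x
==ᵥ-refl (false ∷ x) = ==ᵥ-refl x

∑ : ∀ n → (Vecᶠ n → ℕ) → ℕ
∑ zero f = f []
∑ (suc n) f = ∑ n (λ x → f (true ∷ x)) + ∑ n (λ x → f (false ∷ x))

∑-additive : ∀ n → IsAdditive (∑ n)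
∑-additive n = record { additive-cong = ∑-cong n ; additive-+ = ∑-+ n ; additive-0 = ∑-0 n }
  where
  ∑-cong : ∀ n f g → (∀ z → f z ≡ g z) → ∑ n f ≡ ∑ n g
  ∑-cong zero f g h = h []
  ∑-cong (suc n) f g h = cong₂ _+_ (∑-cong n _ _ (λ z → h (true ∷ z))) (∑-cong n _ _ (λ z → h (false ∷ z)))
  ∑-+ : ∀ n f g → ∑ n (λ z → f z + g z) ≡ ∑ n f + ∑ n g
  ∑-+ zero f g = refl
  ∑-+ (suc n) f g = trans (cong₂ _+_ (∑-+ n (λ x → f (true ∷ x)) (λ x → g (true ∷ x)))
                                      (∑-+ n (λ x → f (false ∷ x)) (λ x → g (false ∷ x))))
                          (+-interchange (∑ n (λ x → f (true ∷ x))) _ _ _)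
  ∑-0 : ∀ n → ∑ n (λ _ → 0) ≡ 0
  ∑-0 zero = refl
  ∑-0 (suc n) = cong₂ _+_ (∑-0 n) (∑-0 n)

vecFinSet : ℕ → FinSet
vecFinSet n = record
  { Carrier = Vecᶠ n ; _==_ = _==ᵥ_ ; ==-sound = ==ᵥ-sound ; ==-refl = ==ᵥ-refl
  ; sum = ∑ n ; sum-additive = ∑-additive n ; sum-delta = delta n ; sum-witness = witness n ; sum-swap = swap n }
  where
  open IsAdditive
  delta : ∀ n x (f : Vecᶠ n → ℕ) → ∑ n (λ y → if y ==ᵥ x then f y else 0) ≡ f x
  delta zero [] f = refl
  delta (suc n) (true ∷ x) f = trans (cong₂ _+_ (delta n x _) (additive-0 (∑-additive n))) (+-identityʳ _)
  delta (suc n) (false ∷ x) f = cong₂ _+_ (additive-0 (∑-additive n)) (delta n x _)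
  witness : ∀ n f → ∑ n f ≢ 0 → Σ (Vecᶠ n) λ x → f x ≢ 0
  witness zero f h = [] , h
  witness (suc n) f h with ∑ n (λ x → f (true ∷ x)) in e
  ... | suc _ = let (x , p) = witness n (λ x → f (true ∷ x)) (λ e′ → 1+n≢0 (trans (sym e) e′)) in true ∷ x , p
  ... | zero = let (x , p) = witness n (λ x → f (false ∷ x)) h in false ∷ x , p
  swap : ∀ n (Z : Set) (L : (Z → ℕ) → ℕ) → IsAdditive L → ∀ (f : Vecᶠ n → Z → ℕ) →
         ∑ n (λ x → L (f x)) ≡ L (λ z → ∑ n (λ x → f x z))
  swap zero Z L aL f = refl
  swap (suc n) Z L aL f = trans (cong₂ _+_ (swap n Z L aL _) (swap n Z L aL _)) (sym (additive-+ aL _ _))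

_×ᶠ_ : FinSet → FinSet → FinSet
A ×ᶠ B = record
  { Carrier = A.Carrier × B.Carrier
  ; _==_ = λ p q → (proj₁ p A.== proj₁ q) ∧ (proj₂ p B.== proj₂ q)
  ; ==-sound = sound
  ; ==-refl = λ p → trans (cong (_∧ (proj₂ p B.== proj₂ p)) (A.==-refl (proj₁ p))) (B.==-refl (proj₂ p))
  ; sum = sum
  ; sum-additive = record
      { additive-cong = λ f g h → A.sum-cong _ _ (λ a → B.sum-cong _ _ (λ b → h (a , b)))
      ; additive-+ = λ f g → trans (A.sum-cong _ _ (λ a → B.sum-+ _ _)) (A.sum-+ _ _)
      ; additive-0 = trans (A.sum-cong _ _ (λ a → B.sum-0)) A.sum-0 }
  ; sum-delta = delta
  ; sum-witness = λ f h → let (a , p) = A.sum-witness _ h ; (b , q) = B.sum-witness _ p in (a , b) , q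
  ; sum-swap = λ Z L aL f → trans (A.sum-cong _ _ (λ a → B.sum-swap Z L aL (λ b → f (a , b))))
                                  (A.sum-swap Z L aL (λ a z → B.sum (λ b → f (a , b) z))) }
  where
  module A = FinSet A
  module B = FinSet B
  sum : (A.Carrier × B.Carrier → ℕ) → ℕ
  sum f = A.sum (λ a → B.sum (λ b → f (a , b)))
  sound : ∀ p q → ((proj₁ p A.== proj₁ q) ∧ (proj₂ p B.== proj₂ q)) ≡ true → p ≡ q
  sound (a , b) (a′ , b′) e = cong₂ _,_ (A.==-sound a a′ (∧-elimˡ _ e)) (B.==-sound b b′ (∧-elimʳ (a A.== a′) e))
  delta : ∀ x (f : A.Carrier × B.Carrier → ℕ) →
          sum (λ y → if (proj₁ y A.== proj₁ x) ∧ (proj₂ y B.== proj₂ x) then f y else 0) ≡ f x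
  delta (a , b) f = trans (A.sum-cong _ _ inner) (A.sum-delta a (λ a′ → f (a′ , b)))
    where
    inner : ∀ a′ → B.sum (λ b′ → if (a′ A.== a) ∧ (b′ B.== b) then f (a′ , b′) else 0)
                 ≡ (if a′ A.== a then f (a′ , b) else 0)
    inner a′ with a′ A.== a
    ... | true = B.sum-delta b (λ b′ → f (a′ , b′))
    ... | false = B.sum-0

module FinSetProperties (A : FinSet) where
  open FinSet A public

  count : (Carrier → Bool) → ℕ
  count P = sum (λ x → 𝟙 (P x))

  sum-*ˡ : ∀ k f → sum (λ x → k * f x) ≡ k * sum f
  sum-*ˡ zero f = sum-0
  sum-*ˡ (suc k) f = trans (sum-+ f (λ x → k * f x)) (cong (sum f +_) (sum-*ˡ k f))

  sum-*ʳ : ∀ k f → sum (λ x → f x * k) ≡ sum f * k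
  sum-*ʳ k f = trans (sum-cong _ _ (λ x → *-comm (f x) k)) (trans (sum-*ˡ k f) (*-comm k (sum f)))

  sum-mono : ∀ f g → (∀ x → f x ≤ g x) → sum f ≤ sum g
  sum-mono f g f≤g = subst (sum f ≤_) (sym sum-g) (m≤m+n _ _)
    where
    sum-g : sum g ≡ sum f + sum (λ x → g x ∸ f x)
    sum-g = trans (sum-cong _ _ (λ x → sym (m+[n∸m]≡n (f≤g x)))) (sum-+ f (λ x → g x ∸ f x))

  ==-sym : ∀ x y → x == y ≡ y == x
  ==-sym x y = ≡true-ext _ _ (λ e → subst (λ z → z == x ≡ true) (==-sound x y e) (==-refl x))
                             (λ e → subst (λ z → z == y ≡ true) (==-sound y x e) (==-refl y))

  count-cong : ∀ (P Q : Carrier → Bool) → (∀ x → P x ≡ Q x) → count P ≡ count Q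
  count-cong P Q h = sum-cong _ _ (λ x → cong 𝟙 (h x))

  count-singleton : ∀ a → count (_== a) ≡ 1
  count-singleton a = trans (sum-cong _ _ (λ y → 𝟙≡if (y == a))) (sum-delta a (λ _ → 1))
    where
    𝟙≡if : ∀ b → 𝟙 b ≡ (if b then 1 else 0)
    𝟙≡if true = refl
    𝟙≡if false = refl

  count-split : ∀ (P Q : Carrier → Bool) → count P ≡ count (λ x → P x ∧ Q x) + count (λ x → P x ∧ not (Q x))
  count-split P Q = trans (sum-cong _ _ (λ x → 𝟙-split (P x) (Q x))) (sum-+ _ _)

  count-∨ : ∀ (P Q : Carrier → Bool) → (∀ x → P x ≡ true → Q x ≡ true → ⊥) →
            count (λ x → P x ∨ Q x) ≡ count P + count Q
  count-∨ P Q disjoint = trans (sum-cong _ _ (λ x → 𝟙-∨ (P x) (Q x) (disjoint x))) (sum-+ _ _)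
    where
    𝟙-∨ : ∀ a b → (a ≡ true → b ≡ true → ⊥) → 𝟙 (a ∨ b) ≡ 𝟙 a + 𝟙 b
    𝟙-∨ true true d = ⊥-elim (d refl refl)
    𝟙-∨ true false d = refl
    𝟙-∨ false b d = refl

  count-witness : ∀ P → count P ≢ 0 → Σ Carrier λ x → P x ≡ true
  count-witness P h with sum-witness _ h
  ... | x , p with P x in e
  ... | true = x , e
  ... | false = ⊥-elim (p refl)

  module Orbits (σ : Carrier → Carrier) (p : ℕ) (σ-periodic : ∀ x → fold x σ (suc p) ≡ x) where

    inOrbit : Carrier → ℕ → Carrier → Bool
    inOrbit x zero y = false
    inOrbit x (suc m) y = inOrbit x m y ∨ (y == fold x σ m)

    inOrbit-sound : ∀ x m y → inOrbit x m y ≡ true → Σ ℕ λ k → (k < m) × (y ≡ fold x σ k)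
    inOrbit-sound x (suc m) y e with inOrbit x m y in e′
    ... | true = let (k , k<m , y≡) = inOrbit-sound x m y e′ in k , m≤n⇒m≤1+n k<m , y≡
    ... | false = m , ≤-refl , ==-sound _ _ e

    inOrbit-complete : ∀ x m k → k < m → inOrbit x m (fold x σ k) ≡ true
    inOrbit-complete x (suc m) k (s≤s k≤m) with m≤n⇒m<n∨m≡n k≤m
    ... | inj₁ k<m = cong (_∨ (fold x σ k == fold x σ m)) (inOrbit-complete x m k k<m)
    ... | inj₂ refl = trans (cong (inOrbit x k (fold x σ k) ∨_) (==-refl _)) (∨-zeroʳ _)

    count-inOrbit : ∀ x m → (∀ i j → i < j → j < m → fold x σ i ≢ fold x σ j) → count (inOrbit x m) ≡ m
    count-inOrbit x zero _ = sum-0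
    count-inOrbit x (suc m) distinct = begin
      count (inOrbit x (suc m))                   ≡⟨ count-∨ (inOrbit x m) (_== fold x σ m) disjoint ⟩
      count (inOrbit x m) + count (_== fold x σ m)
        ≡⟨ cong₂ _+_ (count-inOrbit x m (λ i j i<j j<m → distinct i j i<j (m≤n⇒m≤1+n j<m))) (count-singleton _) ⟩
      m + 1                                       ≡⟨ +-comm m 1 ⟩
      suc m ∎
      where
      open ≡-Reasoning
      disjoint : ∀ y → inOrbit x m y ≡ true → y == fold x σ m ≡ true → ⊥
      disjoint y e e′ = let (k , k<m , y≡) = inOrbit-sound x m y e in distinct k m k<m ≤-refl (trans (sym y≡) (==-sound _ _ e′))

    σ-preimage : ∀ x y k → σ y ≡ fold x σ k → y ≡ fold x σ (p + k)
    σ-preimage x y k σy≡ = begin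
      y                      ≡⟨ sym (σ-periodic y) ⟩
      fold y σ (suc p)       ≡⟨ cong (fold y σ) (+-comm 1 p) ⟩
      fold y σ (p + 1)       ≡⟨ fold-+ y σ p ⟩
      fold (σ y) σ p         ≡⟨ cong (λ t → fold t σ p) σy≡ ⟩
      fold (fold x σ k) σ p  ≡⟨ sym (fold-+ x σ p) ⟩
      fold x σ (p + k) ∎
      where open ≡-Reasoning

    inOrbit-σ⁻¹ : ∀ x y → inOrbit x (suc p) (σ y) ≡ true → inOrbit x (suc p) y ≡ true
    inOrbit-σ⁻¹ x y e with inOrbit-sound x (suc p) (σ y) e
    ... | zero , _ , σy≡x = subst (λ t → inOrbit x (suc p) t ≡ true) (sym y≡σᵖx) (inOrbit-complete x (suc p) p ≤-refl)
      where
      y≡σᵖx : y ≡ fold x σ p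
      y≡σᵖx = trans (σ-preimage x y 0 σy≡x) (cong (fold x σ) (+-identityʳ p))
    ... | suc k , s≤s k<p , σy≡ = subst (λ t → inOrbit x (suc p) t ≡ true) (sym y≡σᵏx) (inOrbit-complete x (suc p) k (m≤n⇒m≤1+n k<p))
      where
      y≡σᵏx : y ≡ fold x σ k
      y≡σᵏx = begin
        y                           ≡⟨ σ-preimage x y (suc k) σy≡ ⟩
        fold x σ (p + suc k)        ≡⟨ cong (fold x σ) (trans (+-suc p k) (+-comm (suc p) k)) ⟩
        fold x σ (k + suc p)        ≡⟨ fold-+ x σ k ⟩
        fold (fold x σ (suc p)) σ k ≡⟨ cong (λ t → fold t σ k) (σ-periodic x) ⟩
        fold x σ k ∎
        where open ≡-Reasoning

    Invariant : (Carrier → Bool) → Set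
    Invariant P = ∀ x → P x ≡ true → P (σ x) ≡ true

    FreeOn : (Carrier → Bool) → Set
    FreeOn P = ∀ x k → P x ≡ true → 0 < k → k < suc p → fold x σ k ≢ x

    iterate-preserves : ∀ {P} → Invariant P → ∀ {x} → P x ≡ true → ∀ k → P (fold x σ k) ≡ true
    iterate-preserves inv Px zero = Px
    iterate-preserves inv Px (suc k) = inv _ (iterate-preserves inv Px k)

    iterates-distinct : ∀ {P} → Invariant P → FreeOn P → ∀ {x} → P x ≡ true →
                        ∀ i j → i < j → j < suc p → fold x σ i ≢ fold x σ j
    iterates-distinct {P} inv free {x} Px i j i<j j<ℓ σⁱx≡σʲx =
      free (fold x σ i) (j ∸ i) (iterate-preserves inv Px i) (m<n⇒0<n∸m i<j) (≤-<-trans (m∸n≤m j i) j<ℓ) σʲ⁻ⁱσⁱx≡σⁱx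
      where
      σʲ⁻ⁱσⁱx≡σⁱx : fold (fold x σ i) σ (j ∸ i) ≡ fold x σ i
      σʲ⁻ⁱσⁱx≡σⁱx = trans (sym (fold-+ x σ (j ∸ i))) (trans (cong (fold x σ) (m∸n+n≡m (<⇒≤ i<j))) (sym σⁱx≡σʲx))

    withoutOrbit : (Carrier → Bool) → Carrier → Carrier → Bool
    withoutOrbit P x y = P y ∧ not (inOrbit x (suc p) y)

    count-withoutOrbit : ∀ {P} → Invariant P → FreeOn P → ∀ {x} → P x ≡ true →
                         count P ≡ count (withoutOrbit P x) + suc p
    count-withoutOrbit {P} inv free {x} Px = begin
      count P                                                  ≡⟨ count-split P (inOrbit x (suc p)) ⟩
      count (λ y → P y ∧ inOrbit x (suc p) y) + count (withoutOrbit P x) ≡⟨ +-comm _ (count (withoutOrbit P x)) ⟩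
      count (withoutOrbit P x) + count (λ y → P y ∧ inOrbit x (suc p) y) ≡⟨ cong (count (withoutOrbit P x) +_) (count-cong _ _ orbit⊆P) ⟩
      count (withoutOrbit P x) + count (inOrbit x (suc p))     ≡⟨ cong (count (withoutOrbit P x) +_) (count-inOrbit x (suc p) (iterates-distinct inv free Px)) ⟩
      count (withoutOrbit P x) + suc p ∎
      where
      open ≡-Reasoning
      orbit⊆P : ∀ y → (P y ∧ inOrbit x (suc p) y) ≡ inOrbit x (suc p) y
      orbit⊆P y with inOrbit x (suc p) y in e
      ... | false = ∧-zeroʳ (P y)
      ... | true = let (k , _ , y≡) = inOrbit-sound x (suc p) y e in
                   cong (_∧ true) (trans (cong P y≡) (iterate-preserves inv Px k))

    withoutOrbit-invariant : ∀ {P} → Invariant P → ∀ x → Invariant (withoutOrbit P x)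
    withoutOrbit-invariant {P} inv x y e with inOrbit x (suc p) (σ y) in e′
    ... | false = cong (_∧ true) (inv y (∧-elimˡ (P y) e))
    ... | true = ⊥-elim (false≢true (trans (sym (not-true _ (∧-elimʳ (P y) e))) (inOrbit-σ⁻¹ x y e′)))

    withoutOrbit-free : ∀ {P} → FreeOn P → ∀ x → FreeOn (withoutOrbit P x)
    withoutOrbit-free {P} free x y k e = free y k (∧-elimˡ (P y) e)

    period∣count : ∀ bound P → count P ≤ bound → Invariant P → FreeOn P → suc p ∣ count P
    period∣count bound P _ inv free with count P in eq
    ... | zero = divides 0 refl
    period∣count (suc bound) P (s≤s c≤b) inv free | suc c =
      subst (suc p ∣_) (trans (sym split) eq) (∣m∣n⇒∣m+n rest∣ ∣-refl)
      where
      witness = count-witness P (λ e → 1+n≢0 (trans (sym eq) e))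
      x = proj₁ witness
      split : count P ≡ count (withoutOrbit P x) + suc p
      split = count-withoutOrbit inv free (proj₂ witness)
      rest≤c : count (withoutOrbit P x) ≤ c
      rest≤c = subst (count (withoutOrbit P x) ≤_)
        (suc-injective (trans (sym (+-suc (count (withoutOrbit P x)) p)) (trans (sym split) eq))) (m≤m+n _ p)
      rest∣ : suc p ∣ count (withoutOrbit P x)
      rest∣ = period∣count bound (withoutOrbit P x) (≤-trans rest≤c c≤b)
                (withoutOrbit-invariant inv x) (withoutOrbit-free free x)

module Count (n : ℕ) = FinSetProperties (vecFinSet n)

∑-const-1 : ∀ n → ∑ n (λ _ → 1) ≡ 2 ^ n
∑-const-1 zero = refl
∑-const-1 (suc n) = trans (cong₂ _+_ (∑-const-1 n) (∑-const-1 n)) (cong (2 ^ n +_) (sym (+-identityʳ _)))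

-- Spans and linear independence

anyᵥ : ∀ m → (Vecᶠ m → Bool) → Bool
anyᵥ zero P = P []
anyᵥ (suc m) P = anyᵥ m (λ c → P (true ∷ c)) ∨ anyᵥ m (λ c → P (false ∷ c))

anyᵥ-sound : ∀ m P → anyᵥ m P ≡ true → Σ (Vecᶠ m) λ c → P c ≡ true
anyᵥ-sound zero P e = [] , e
anyᵥ-sound (suc m) P e with anyᵥ m (λ c → P (true ∷ c)) in e′
... | true = let (c , Pc) = anyᵥ-sound m _ e′ in true ∷ c , Pc
... | false = let (c , Pc) = anyᵥ-sound m _ e in false ∷ c , Pc

anyᵥ-complete : ∀ m P c → P c ≡ true → anyᵥ m P ≡ true
anyᵥ-complete zero P [] e = e
anyᵥ-complete (suc m) P (true ∷ c) e rewrite anyᵥ-complete m (λ c → P (true ∷ c)) c e = refl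
anyᵥ-complete (suc m) P (false ∷ c) e rewrite anyᵥ-complete m (λ c → P (false ∷ c)) c e = ∨-zeroʳ _

anyᵥ-false : ∀ m P → anyᵥ m P ≡ false → ∀ c → P c ≡ false
anyᵥ-false m P e c with P c in e′
... | false = refl
... | true = ⊥-elim (false≢true (trans (sym e) (anyᵥ-complete m P c e′)))

2^-cancel-≤ : ∀ a b → 2 ^ a ≤ 2 ^ b → a ≤ b
2^-cancel-≤ a b le with a ≤? b
... | yes a≤b = a≤b
... | no a≰b = ⊥-elim (<⇒≱ (^-monoʳ-< 2 (s≤s (s≤s z≤n)) (≰⇒> a≰b)) le)

module Image {m k : ℕ} (g : Vecᶠ m → Vecᶠ k) where

  inImage : Vecᶠ k → Bool
  inImage y = anyᵥ m (λ c → g c ==ᵥ y)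

  fibreSize : Vecᶠ k → ℕ
  fibreSize y = ∑ m (λ c → 𝟙 (g c ==ᵥ y))

  ∑-fibreSize : ∑ k fibreSize ≡ 2 ^ m
  ∑-fibreSize = trans (FinSet.sum-swap (vecFinSet k) (Vecᶠ m) (∑ m) (∑-additive m) (λ y c → 𝟙 (g c ==ᵥ y)))
                      (trans (IsAdditive.additive-cong (∑-additive m) _ _ one) (∑-const-1 m))
    where
    one : ∀ c → ∑ k (λ y → 𝟙 (g c ==ᵥ y)) ≡ 1
    one c = trans (Count.count-cong k _ _ (λ y → Count.==-sym k (g c) y)) (Count.count-singleton k (g c))

  𝟙-inImage≤fibreSize : ∀ y → 𝟙 (inImage y) ≤ fibreSize y
  𝟙-inImage≤fibreSize y with inImage y in e
  ... | false = z≤n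
  ... | true = let (c , gc≡y) = anyᵥ-sound m _ e in
      subst (_≤ fibreSize y) (Count.count-singleton m c) (Count.sum-mono m _ _ (λ c′ → le c′ c gc≡y))
    where
    le : ∀ c′ c → g c ==ᵥ y ≡ true → 𝟙 (c′ ==ᵥ c) ≤ 𝟙 (g c′ ==ᵥ y)
    le c′ c p with c′ ==ᵥ c in e′
    ... | false = z≤n
    ... | true rewrite ==ᵥ-sound c′ c e′ | p = ≤-refl

  surjective⇒≥ : (∀ y → inImage y ≡ true) → 2 ^ k ≤ 2 ^ m
  surjective⇒≥ surj = subst₂ _≤_ (∑-const-1 k) ∑-fibreSize
    (Count.sum-mono k _ _ (λ y → subst (λ b → 𝟙 b ≤ fibreSize y) (surj y) (𝟙-inImage≤fibreSize y)))

  module Injective (inj : ∀ c c′ → g c ≡ g c′ → c ≡ c′) where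

    𝟙-inImage≡fibreSize : ∀ y → 𝟙 (inImage y) ≡ fibreSize y
    𝟙-inImage≡fibreSize y with inImage y in e
    ... | false = sym (trans (Count.sum-cong m _ _ (λ c → cong 𝟙 (anyᵥ-false m _ e c))) (Count.sum-0 m))
    ... | true = let (c , gc≡y) = anyᵥ-sound m _ e in
      sym (trans (Count.sum-cong m _ _ (λ c′ → cong 𝟙 (fibre c′ c gc≡y))) (Count.count-singleton m c))
      where
      fibre : ∀ c′ c → g c ==ᵥ y ≡ true → g c′ ==ᵥ y ≡ c′ ==ᵥ c
      fibre c′ c p = ≡true-ext _ _
        (λ e′ → subst (λ t → c′ ==ᵥ t ≡ true) (inj c′ c (trans (==ᵥ-sound _ _ e′) (sym (==ᵥ-sound _ _ p)))) (==ᵥ-refl c′))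
        (λ e′ → subst (λ t → g t ==ᵥ y ≡ true) (sym (==ᵥ-sound _ _ e′)) p)

    count-inImage : Count.count k inImage ≡ 2 ^ m
    count-inImage = trans (Count.sum-cong k _ _ 𝟙-inImage≡fibreSize) ∑-fibreSize

    injective⇒≤ : 2 ^ m ≤ 2 ^ k
    injective⇒≤ = subst₂ _≤_ count-inImage (∑-const-1 k) (Count.sum-mono k _ _ (λ y → 𝟙≤1 (inImage y)))

inSpan : ∀ {k m} → Vec (Vecᶠ k) m → Vecᶠ k → Bool
inSpan {k} {m} b = Image.inImage {m} {k} (_·ᵥ b)

inSpan-·ᵥ : ∀ {k m} (b : Vec (Vecᶠ k) m) c → inSpan b (c ·ᵥ b) ≡ true
inSpan-·ᵥ {k} {m} b c = anyᵥ-complete m (λ c′ → (c′ ·ᵥ b) ==ᵥ (c ·ᵥ b)) c (==ᵥ-refl (c ·ᵥ b))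

inSpan⇒·ᵥ : ∀ {k m} (b : Vec (Vecᶠ k) m) y → inSpan b y ≡ true → Σ (Vecᶠ m) λ c → c ·ᵥ b ≡ y
inSpan⇒·ᵥ {k} {m} b y e = let (c , p) = anyᵥ-sound m _ e in c , ==ᵥ-sound _ _ p

Spanning : ∀ {k m} → Vec (Vecᶠ k) m → Set
Spanning b = ∀ y → inSpan b y ≡ true

inSpan-⊕ : ∀ {k m} (b : Vec (Vecᶠ k) m) x y → inSpan b x ≡ true → inSpan b y ≡ true → inSpan b (x ⊕ y) ≡ true
inSpan-⊕ b x y ex ey with inSpan⇒·ᵥ b x ex | inSpan⇒·ᵥ b y ey
... | cx , px | cy , py = subst (λ t → inSpan b t ≡ true) (trans (·ᵥ-distribʳ-⊕ cx cy b) (cong₂ _⊕_ px py)) (inSpan-·ᵥ b (cx ⊕ cy))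

inSpan-⊆ : ∀ {k m j} (b : Vec (Vecᶠ k) m) (cs : Vec (Vecᶠ m) j) →
           ∀ z → inSpan (map (_·ᵥ b) cs) z ≡ true → inSpan b z ≡ true
inSpan-⊆ b cs z ez with inSpan⇒·ᵥ (map (_·ᵥ b) cs) z ez
... | c , p = subst (λ t → inSpan b t ≡ true) (trans (sym (·ᵥ-assoc c cs b)) p) (inSpan-·ᵥ b (c ·ᵥ cs))

Independent : ∀ {k m} → Vec (Vecᶠ k) m → Set
Independent b = ∀ c → c ·ᵥ b ≡ zeroV → c ≡ zeroV

Independent⇒LinIndep : ∀ {k m} (b : Vec (Vecᶠ k) m) → Independent b → LinIndep b
Independent⇒LinIndep b h c e = h c (trans (sym (lincomb≡·ᵥ c b)) e)

LinIndep⇒Independent : ∀ {k m} (b : Vec (Vecᶠ k) m) → LinIndep b → Independent b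
LinIndep⇒Independent b h c e = h c (trans (lincomb≡·ᵥ c b) e)

independent-injective : ∀ {k m} (b : Vec (Vecᶠ k) m) → Independent b → ∀ c c′ → c ·ᵥ b ≡ c′ ·ᵥ b → c ≡ c′
independent-injective b h c c′ e = ⊕≡0⇒≡ c c′ (h (c ⊕ c′) (trans (·ᵥ-distribʳ-⊕ c c′ b) (≡⇒⊕≡0 e)))

independent⇒≤ : ∀ {k m} (b : Vec (Vecᶠ k) m) → Independent b → m ≤ k
independent⇒≤ {k} {m} b h = 2^-cancel-≤ m k (Image.Injective.injective⇒≤ (_·ᵥ b) (independent-injective b h))

spanning⇒≥ : ∀ {k m} (b : Vec (Vecᶠ k) m) → Spanning b → k ≤ m
spanning⇒≥ {k} {m} b h = 2^-cancel-≤ k m (Image.surjective⇒≥ (_·ᵥ b) h)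

count-inSpan : ∀ {k m} (b : Vec (Vecᶠ k) m) → Independent b → Count.count k (inSpan b) ≡ 2 ^ m
count-inSpan b h = Image.Injective.count-inImage (_·ᵥ b) (independent-injective b h)

independent-insert : ∀ {k a b} (P : Vec (Vecᶠ k) a) (U : Vec (Vecᶠ k) b) u →
                     Independent (P ++ U) → inSpan (P ++ U) u ≡ false → Independent (P ++ (u ∷ U))
independent-insert {a = a} P U u h u∉ c e with splitAt a c
... | c₁ , (true ∷ c₂) , refl =
  ⊥-elim (false≢true (trans (sym u∉) (subst (λ t → inSpan (P ++ U) t ≡ true) u≡ (inSpan-·ᵥ (P ++ U) (c₁ ++ c₂)))))
  where
  u≡ : (c₁ ++ c₂) ·ᵥ (P ++ U) ≡ u
  u≡ = begin
    (c₁ ++ c₂) ·ᵥ (P ++ U)                           ≡⟨ ++-·ᵥ-++ c₁ c₂ P U ⟩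
    (c₁ ·ᵥ P) ⊕ (c₂ ·ᵥ U)                            ≡⟨ sym (⊕-cancelʳ u _) ⟩
    (((c₁ ·ᵥ P) ⊕ (c₂ ·ᵥ U)) ⊕ u) ⊕ u                ≡⟨ cong (_⊕ u) (⊕-assoc (c₁ ·ᵥ P) (c₂ ·ᵥ U) u) ⟩
    ((c₁ ·ᵥ P) ⊕ ((c₂ ·ᵥ U) ⊕ u)) ⊕ u                ≡⟨ cong (λ t → ((c₁ ·ᵥ P) ⊕ t) ⊕ u) (⊕-comm (c₂ ·ᵥ U) u) ⟩
    ((c₁ ·ᵥ P) ⊕ (u ⊕ (c₂ ·ᵥ U))) ⊕ u                ≡⟨ cong (λ t → ((c₁ ·ᵥ P) ⊕ (t ⊕ (c₂ ·ᵥ U))) ⊕ u) (sym (scale-true u)) ⟩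
    ((c₁ ·ᵥ P) ⊕ (scale true u ⊕ (c₂ ·ᵥ U))) ⊕ u    ≡⟨ cong (_⊕ u) (trans (sym (++-·ᵥ-++ c₁ (true ∷ c₂) P (u ∷ U))) e) ⟩
    zeroV ⊕ u                                         ≡⟨ ⊕-identityˡ u ⟩
    u ∎
    where open ≡-Reasoning
... | c₁ , (false ∷ c₂) , refl = trans (cong₂ (λ x y → x ++ (false ∷ y)) (proj₁ c≡0) (proj₂ c≡0)) (sym (zeroV-++ a _))
  where
  e′ : (c₁ ++ c₂) ·ᵥ (P ++ U) ≡ zeroV
  e′ = begin
    (c₁ ++ c₂) ·ᵥ (P ++ U)                         ≡⟨ ++-·ᵥ-++ c₁ c₂ P U ⟩
    (c₁ ·ᵥ P) ⊕ (c₂ ·ᵥ U)                          ≡⟨ cong ((c₁ ·ᵥ P) ⊕_) (sym (⊕-identityˡ _)) ⟩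
    (c₁ ·ᵥ P) ⊕ (zeroV ⊕ (c₂ ·ᵥ U))                ≡⟨ cong (λ t → (c₁ ·ᵥ P) ⊕ (t ⊕ (c₂ ·ᵥ U))) (sym (scale-false u)) ⟩
    (c₁ ·ᵥ P) ⊕ (scale false u ⊕ (c₂ ·ᵥ U))        ≡⟨ sym (++-·ᵥ-++ c₁ (false ∷ c₂) P (u ∷ U)) ⟩
    (c₁ ++ (false ∷ c₂)) ·ᵥ (P ++ (u ∷ U))         ≡⟨ e ⟩
    zeroV ∎
    where open ≡-Reasoning
  c≡0 = ++≡zeroV c₁ c₂ (h (c₁ ++ c₂) e′)

independent-++[] : ∀ {k a} (P : Vec (Vecᶠ k) a) → Independent P → Independent (P ++ [])
independent-++[] {a = a} P indep c e with splitAt a c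
... | c₁ , [] , refl =
  trans (cong (_++ []) (indep c₁ (trans (sym (⊕-identityʳ _)) (trans (sym (++-·ᵥ-++ c₁ [] P [])) e)))) (sym (zeroV-++ a 0))

-- Normal form of an involution

double : ℕ → ℕ
double zero = 0
double (suc s) = suc (suc (double s))

double≡2* : ∀ s → double s ≡ 2 * s
double≡2* zero = refl
double≡2* (suc s) = cong suc (trans (cong suc (double≡2* s)) (sym (+-suc s (s + 0))))

evens : ∀ {s} → Vecᶠ (double s) → Vecᶠ s
evens {zero} [] = []
evens {suc s} (a ∷ b ∷ c) = a ∷ evens c

odds : ∀ {s} → Vecᶠ (double s) → Vecᶠ s
odds {zero} [] = []
odds {suc s} (a ∷ b ∷ c) = b ∷ odds c

interleave : ∀ {s} → Vecᶠ s → Vecᶠ s → Vecᶠ (double s)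
interleave [] [] = []
interleave (a ∷ x) (b ∷ y) = a ∷ b ∷ interleave x y

evens-interleave : ∀ {s} (x y : Vecᶠ s) → evens (interleave x y) ≡ x
evens-interleave [] [] = refl
evens-interleave (a ∷ x) (b ∷ y) = cong (a ∷_) (evens-interleave x y)

odds-interleave : ∀ {s} (x y : Vecᶠ s) → odds (interleave x y) ≡ y
odds-interleave [] [] = refl
odds-interleave (a ∷ x) (b ∷ y) = cong (b ∷_) (odds-interleave x y)

interleave-evens-odds : ∀ {s} (c : Vecᶠ (double s)) → interleave (evens c) (odds c) ≡ c
interleave-evens-odds {zero} [] = refl
interleave-evens-odds {suc s} (a ∷ b ∷ c) = cong (λ t → a ∷ b ∷ t) (interleave-evens-odds c)

interleave-zeroV : ∀ s → interleave (zeroV {s}) zeroV ≡ zeroV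
interleave-zeroV zero = refl
interleave-zeroV (suc s) = cong (λ t → false ∷ false ∷ t) (interleave-zeroV s)

evens-zeroV : ∀ s → evens (zeroV {double s}) ≡ zeroV
evens-zeroV zero = refl
evens-zeroV (suc s) = cong (false ∷_) (evens-zeroV s)

module Involution {v : ℕ} (A : Mat v) (A²≡I : A ·ₘ A ≡ idMat) where

  ·A-involutive : ∀ x → (x ·ᵥ A) ·ᵥ A ≡ x
  ·A-involutive x = trans (sym (·ᵥ-assoc x A A)) (trans (cong (x ·ᵥ_) A²≡I) (·ᵥ-identityʳ x))

  A+I : Vecᶠ v → Vecᶠ v
  A+I x = (x ·ᵥ A) ⊕ x

  A+I-⊕ : ∀ x y → A+I (x ⊕ y) ≡ A+I x ⊕ A+I y
  A+I-⊕ x y = trans (cong (_⊕ (x ⊕ y)) (·ᵥ-distribʳ-⊕ x y A)) (⊕-interchange _ _ _ _)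

  A+I-zeroV : A+I zeroV ≡ zeroV
  A+I-zeroV = trans (cong (_⊕ zeroV) (·ᵥ-zeroˡ A)) (⊕-same zeroV)

  A+I-·ᵥ : ∀ {m} (c : Vecᶠ m) (X : Vec (Vecᶠ v) m) → A+I (c ·ᵥ X) ≡ c ·ᵥ map A+I X
  A+I-·ᵥ [] [] = A+I-zeroV
  A+I-·ᵥ (a ∷ c) (x ∷ X) = trans (A+I-⊕ (scale a x) (c ·ᵥ X)) (cong₂ _⊕_ A+I-scale (A+I-·ᵥ c X))
    where
    A+I-scale : A+I (scale a x) ≡ scale a (A+I x)
    A+I-scale = trans (cong (_⊕ scale a x) (·ᵥ-scale a x A)) (sym (scale-distribˡ-⊕ a _ _))

  A+I-·A : ∀ x → A+I (x ·ᵥ A) ≡ A+I x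
  A+I-·A x = trans (cong (_⊕ (x ·ᵥ A)) (·A-involutive x)) (⊕-comm x (x ·ᵥ A))

  A+I-nilpotent : ∀ x → A+I (A+I x) ≡ zeroV
  A+I-nilpotent x = trans (A+I-⊕ (x ·ᵥ A) x) (trans (cong (_⊕ A+I x) (A+I-·A x)) (⊕-same (A+I x)))

  ·ᵥ-map-A+I : ∀ {m} (c : Vecᶠ m) (X : Vec (Vecᶠ v) m) → c ·ᵥ map A+I X ≡ (c ·ᵥ map (_·ᵥ A) X) ⊕ (c ·ᵥ X)
  ·ᵥ-map-A+I c X = trans (cong (c ·ᵥ_) (map-A+I X)) (·ᵥ-distribˡ-⊕ c _ X)
    where
    map-A+I : ∀ {m} (X : Vec (Vecᶠ v) m) → map A+I X ≡ zipWith _⊕_ (map (_·ᵥ A) X) X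
    map-A+I [] = refl
    map-A+I (x ∷ X) = cong (A+I x ∷_) (map-A+I X)

  map-A+I-·A : ∀ {m} (X : Vec (Vecᶠ v) m) → map A+I (map (_·ᵥ A) X) ≡ map A+I X
  map-A+I-·A [] = refl
  map-A+I-·A (x ∷ X) = cong₂ _∷_ (A+I-·A x) (map-A+I-·A X)

  isFixed : Vecᶠ v → Bool
  isFixed x = A+I x ==ᵥ zeroV

  isFixed⇒A+I≡0 : ∀ x → isFixed x ≡ true → A+I x ≡ zeroV
  isFixed⇒A+I≡0 x = ==ᵥ-sound _ _

  A+I≡0⇒isFixed : ∀ x → A+I x ≡ zeroV → isFixed x ≡ true
  A+I≡0⇒isFixed x e = subst (λ t → t ==ᵥ zeroV ≡ true) (sym e) (==ᵥ-refl (zeroV {v}))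

  All-fixed : ∀ {m} → Vec (Vecᶠ v) m → Set
  All-fixed U = map A+I U ≡ replicate _ zeroV

  fixed-·ᵥ : ∀ {m} (c : Vecᶠ m) (U : Vec (Vecᶠ v) m) → All-fixed U → A+I (c ·ᵥ U) ≡ zeroV
  fixed-·ᵥ c U fixed = trans (A+I-·ᵥ c U) (trans (cong (c ·ᵥ_) fixed) (·ᵥ-zeroʳ c))

  pairs : ∀ {s} → Vec (Vecᶠ v) s → Vec (Vecᶠ v) (double s)
  pairs [] = []
  pairs (x ∷ X) = x ∷ (x ·ᵥ A) ∷ pairs X

  ·ᵥ-pairs : ∀ {s} (c : Vecᶠ (double s)) (X : Vec (Vecᶠ v) s) →
             c ·ᵥ pairs X ≡ (evens c ·ᵥ X) ⊕ (odds c ·ᵥ map (_·ᵥ A) X)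
  ·ᵥ-pairs {zero} [] [] = sym (⊕-same zeroV)
  ·ᵥ-pairs {suc s} (a ∷ b ∷ c) (x ∷ X) = begin
    scale a x ⊕ (scale b (x ·ᵥ A) ⊕ (c ·ᵥ pairs X))                         ≡⟨ cong (λ t → scale a x ⊕ (scale b (x ·ᵥ A) ⊕ t)) (·ᵥ-pairs c X) ⟩
    scale a x ⊕ (scale b (x ·ᵥ A) ⊕ ((evens c ·ᵥ X) ⊕ (odds c ·ᵥ XA)))
      ≡⟨ cong (scale a x ⊕_) (trans (sym (⊕-assoc _ _ _)) (trans (cong (_⊕ (odds c ·ᵥ XA)) (⊕-comm _ _)) (⊕-assoc _ _ _))) ⟩
    scale a x ⊕ ((evens c ·ᵥ X) ⊕ (scale b (x ·ᵥ A) ⊕ (odds c ·ᵥ XA)))     ≡⟨ sym (⊕-assoc _ _ _) ⟩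
    (scale a x ⊕ (evens c ·ᵥ X)) ⊕ (scale b (x ·ᵥ A) ⊕ (odds c ·ᵥ XA)) ∎
    where
    open ≡-Reasoning
    XA = map (_·ᵥ A) X

  ·ᵥ-pairs-interleave : ∀ {s} (a b : Vecᶠ s) (X : Vec (Vecᶠ v) s) →
                        interleave a b ·ᵥ pairs X ≡ (a ·ᵥ X) ⊕ (b ·ᵥ map (_·ᵥ A) X)
  ·ᵥ-pairs-interleave a b X =
    trans (·ᵥ-pairs _ X) (cong₂ (λ p q → (p ·ᵥ X) ⊕ (q ·ᵥ map (_·ᵥ A) X)) (evens-interleave a b) (odds-interleave a b))

  A+I-pair : ∀ {s} (a b : Vecᶠ s) (X : Vec (Vecᶠ v) s) →
             A+I ((a ·ᵥ X) ⊕ (b ·ᵥ map (_·ᵥ A) X)) ≡ (a ⊕ b) ·ᵥ map A+I X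
  A+I-pair a b X = begin
    A+I ((a ·ᵥ X) ⊕ (b ·ᵥ map (_·ᵥ A) X))            ≡⟨ A+I-⊕ _ _ ⟩
    A+I (a ·ᵥ X) ⊕ A+I (b ·ᵥ map (_·ᵥ A) X)          ≡⟨ cong₂ _⊕_ (A+I-·ᵥ a X) (trans (A+I-·ᵥ b _) (cong (b ·ᵥ_) (map-A+I-·A X))) ⟩
    (a ·ᵥ map A+I X) ⊕ (b ·ᵥ map A+I X)               ≡⟨ sym (·ᵥ-distribʳ-⊕ a b _) ⟩
    (a ⊕ b) ·ᵥ map A+I X ∎
    where open ≡-Reasoning

  pairs-independent : ∀ {s} (X : Vec (Vecᶠ v) s) → Independent (map A+I X) → Independent (pairs X)
  pairs-independent X indep c e = begin
    c                                ≡⟨ sym (interleave-evens-odds c) ⟩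
    interleave (evens c) (odds c)    ≡⟨ cong₂ interleave a≡0 (trans (sym a≡b) a≡0) ⟩
    interleave zeroV zeroV           ≡⟨ interleave-zeroV _ ⟩
    zeroV ∎
    where
    open ≡-Reasoning
    a = evens c
    b = odds c
    combination≡0 : (a ·ᵥ X) ⊕ (b ·ᵥ map (_·ᵥ A) X) ≡ zeroV
    combination≡0 = trans (sym (·ᵥ-pairs c X)) e
    a≡b : a ≡ b
    a≡b = ⊕≡0⇒≡ a b (indep (a ⊕ b) (trans (sym (A+I-pair a b X)) (trans (cong A+I combination≡0) A+I-zeroV)))
    a≡0 : a ≡ zeroV
    a≡0 = indep a (trans (·ᵥ-map-A+I a X) (trans (⊕-comm _ _)
            (subst (λ t → (a ·ᵥ X) ⊕ (t ·ᵥ map (_·ᵥ A) X) ≡ zeroV) (sym a≡b) combination≡0)))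

  SpansImage : ∀ {s} → Vec (Vecᶠ v) s → Set
  SpansImage X = ∀ y → inSpan (map A+I X) (A+I y) ≡ true

  ImageBasis : Set
  ImageBasis = Σ ℕ λ s → Σ (Vec (Vecᶠ v) s) λ X → Independent (map A+I X) × SpansImage X

  extendImageBasis : ∀ fuel {s} → s + fuel ≡ suc v → (X : Vec (Vecᶠ v) s) → Independent (map A+I X) → ImageBasis
  extendImageBasis zero {s} eq X indep =
    ⊥-elim (<⇒≱ (n<1+n v) (subst (_≤ v) (trans (sym (+-identityʳ s)) eq) (independent⇒≤ (map A+I X) indep)))
  extendImageBasis (suc fuel) {s} eq X indep with anyᵥ v (λ y → not (inSpan (map A+I X) (A+I y))) in e
  ... | false = s , X , indep , (λ y → not-false _ (anyᵥ-false v _ e y))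
  ... | true = let (y , y∉) = anyᵥ-sound v _ e in
      extendImageBasis fuel (trans (sym (+-suc s fuel)) eq) (y ∷ X)
        (independent-insert [] (map A+I X) (A+I y) indep (not-true _ y∉))

  imageBasis : ImageBasis
  imageBasis = extendImageBasis (suc v) refl [] (λ { [] _ → refl })

  module Completion {s} (X : Vec (Vecᶠ v) s) (indepX : Independent (map A+I X)) (spansX : SpansImage X) where

    Completed : Set
    Completed = Σ ℕ λ m → Σ (Vec (Vecᶠ v) m) λ U → All-fixed U × Independent (pairs X ++ U) × Spanning (pairs X ++ U)

    combination-of-X : ∀ {m} (c : Vecᶠ s) (U : Vec (Vecᶠ v) m) → (interleave c zeroV ++ zeroV {m}) ·ᵥ (pairs X ++ U) ≡ c ·ᵥ X
    combination-of-X {m} c U = begin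
      (interleave c zeroV ++ zeroV) ·ᵥ (pairs X ++ U)          ≡⟨ ++-·ᵥ-++ (interleave c zeroV) (zeroV {m}) (pairs X) U ⟩
      (interleave c zeroV ·ᵥ pairs X) ⊕ (zeroV ·ᵥ U)           ≡⟨ cong₂ _⊕_ (·ᵥ-pairs-interleave c zeroV X) (·ᵥ-zeroˡ U) ⟩
      ((c ·ᵥ X) ⊕ (zeroV ·ᵥ map (_·ᵥ A) X)) ⊕ zeroV            ≡⟨ ⊕-identityʳ _ ⟩
      (c ·ᵥ X) ⊕ (zeroV ·ᵥ map (_·ᵥ A) X)                      ≡⟨ cong ((c ·ᵥ X) ⊕_) (·ᵥ-zeroˡ (map (_·ᵥ A) X)) ⟩
      (c ·ᵥ X) ⊕ zeroV                                        ≡⟨ ⊕-identityʳ _ ⟩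
      c ·ᵥ X ∎
      where open ≡-Reasoning

    -- A vector y outside the span is corrected by an element c X of span X, with the same
    -- image under A+I, to a fixed vector that is still outside the span.
    complete : ∀ fuel {m} → double s + m + fuel ≡ suc v → (U : Vec (Vecᶠ v) m) → All-fixed U →
               Independent (pairs X ++ U) → Completed
    complete zero {m} eq U fixedU indep =
      ⊥-elim (<⇒≱ (n<1+n v) (subst (_≤ v) (trans (sym (+-identityʳ _)) eq) (independent⇒≤ (pairs X ++ U) indep)))
    complete (suc fuel) {m} eq U fixedU indep with anyᵥ v (λ y → not (inSpan (pairs X ++ U) y)) in e
    ... | false = m , U , fixedU , indep , (λ y → not-false _ (anyᵥ-false v _ e y))
    ... | true = complete fuel (trans (cong (_+ fuel) (+-suc (double s) m)) (trans (sym (+-suc _ fuel)) eq))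
                   (u ∷ U) (cong₂ _∷_ A+Iu≡0 fixedU) (independent-insert (pairs X) U u indep u∉)
      where
      C = pairs X ++ U
      y = proj₁ (anyᵥ-sound v _ e)
      y∉ : inSpan C y ≡ false
      y∉ = not-true _ (proj₂ (anyᵥ-sound v _ e))
      c = proj₁ (inSpan⇒·ᵥ (map A+I X) (A+I y) (spansX y))
      u = y ⊕ (c ·ᵥ X)
      A+Iu≡0 : A+I u ≡ zeroV
      A+Iu≡0 = trans (A+I-⊕ y _) (trans (cong (A+I y ⊕_) (trans (A+I-·ᵥ c X) (proj₂ (inSpan⇒·ᵥ (map A+I X) (A+I y) (spansX y)))))
                                        (⊕-same (A+I y)))
      u∉ : inSpan C u ≡ false
      u∉ with inSpan C u in eu
      ... | false = refl
      ... | true = ⊥-elim (false≢true (trans (sym y∉)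
                     (subst (λ t → inSpan C t ≡ true) y≡ (inSpan-·ᵥ C (c′ ⊕ (interleave c zeroV ++ zeroV))))))
        where
        c′ = proj₁ (inSpan⇒·ᵥ C u eu)
        y≡ : (c′ ⊕ (interleave c zeroV ++ zeroV)) ·ᵥ C ≡ y
        y≡ = trans (·ᵥ-distribʳ-⊕ c′ _ C) (trans (cong₂ _⊕_ (proj₂ (inSpan⇒·ᵥ C u eu)) (combination-of-X c U)) (⊕-cancelʳ (c ·ᵥ X) y))

    completed : Completed
    completed = complete (suc v ∸ double s) start [] refl (independent-++[] (pairs X) (pairs-independent X indepX))
      where
      start : double s + 0 + (suc v ∸ double s) ≡ suc v
      start = trans (cong (_+ (suc v ∸ double s)) (+-identityʳ (double s)))
                (m+[n∸m]≡n (m≤n⇒m≤1+n (independent⇒≤ (pairs X) (pairs-independent X indepX))))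

    module FixedSpace {m} (U : Vec (Vecᶠ v) m) (fixedU : All-fixed U)
                      (indepC : Independent (pairs X ++ U)) (spanningC : Spanning (pairs X ++ U)) where

      W = map A+I X
      XA = map (_·ᵥ A) X
      B = W ++ U

      B-independent : Independent B
      B-independent c e with splitAt s c
      ... | c₁ , c₂ , refl = trans (cong₂ _++_ c₁≡0 (proj₂ both≡0)) (sym (zeroV-++ s m))
        where
        pairsCombination : (interleave c₁ c₁ ++ c₂) ·ᵥ (pairs X ++ U) ≡ zeroV
        pairsCombination = begin
          (interleave c₁ c₁ ++ c₂) ·ᵥ (pairs X ++ U)        ≡⟨ ++-·ᵥ-++ (interleave c₁ c₁) c₂ (pairs X) U ⟩
          (interleave c₁ c₁ ·ᵥ pairs X) ⊕ (c₂ ·ᵥ U)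
            ≡⟨ cong (_⊕ (c₂ ·ᵥ U)) (trans (·ᵥ-pairs-interleave c₁ c₁ X) (trans (⊕-comm _ _) (sym (·ᵥ-map-A+I c₁ X)))) ⟩
          (c₁ ·ᵥ W) ⊕ (c₂ ·ᵥ U)                              ≡⟨ sym (++-·ᵥ-++ c₁ c₂ W U) ⟩
          (c₁ ++ c₂) ·ᵥ (W ++ U)                             ≡⟨ e ⟩
          zeroV ∎
          where open ≡-Reasoning
        both≡0 = ++≡zeroV _ c₂ (indepC _ pairsCombination)
        c₁≡0 : c₁ ≡ zeroV
        c₁≡0 = trans (sym (evens-interleave c₁ c₁)) (trans (cong evens (proj₁ both≡0)) (evens-zeroV s))

      B-fixed : ∀ (c : Vecᶠ (s + m)) → A+I (c ·ᵥ B) ≡ zeroV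
      B-fixed c with splitAt s c
      ... | c₁ , c₂ , refl = begin
        A+I ((c₁ ++ c₂) ·ᵥ (W ++ U))           ≡⟨ cong A+I (++-·ᵥ-++ c₁ c₂ W U) ⟩
        A+I ((c₁ ·ᵥ W) ⊕ (c₂ ·ᵥ U))            ≡⟨ A+I-⊕ _ _ ⟩
        A+I (c₁ ·ᵥ W) ⊕ A+I (c₂ ·ᵥ U)          ≡⟨ cong₂ _⊕_ (fixed-·ᵥ c₁ W (W-fixed X)) (fixed-·ᵥ c₂ U fixedU) ⟩
        zeroV ⊕ zeroV                           ≡⟨ ⊕-same zeroV ⟩
        zeroV ∎
        where
        open ≡-Reasoning
        W-fixed : ∀ {k} (Y : Vec (Vecᶠ v) k) → All-fixed (map A+I Y)
        W-fixed [] = refl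
        W-fixed (y ∷ Y) = cong₂ _∷_ (A+I-nilpotent y) (W-fixed Y)

      fixed⇒inSpan-B : ∀ y → A+I y ≡ zeroV → inSpan B y ≡ true
      fixed⇒inSpan-B y A+Iy≡0 with inSpan⇒·ᵥ (pairs X ++ U) y (spanningC y)
      ... | c , c·C≡y with splitAt (double s) c
      ... | c₁ , c₂ , refl = subst (λ t → inSpan B t ≡ true) a·B≡y (inSpan-·ᵥ B (a ++ c₂))
        where
        a = evens c₁
        b = odds c₁
        y≡ : ((a ·ᵥ X) ⊕ (b ·ᵥ XA)) ⊕ (c₂ ·ᵥ U) ≡ y
        y≡ = trans (cong (_⊕ (c₂ ·ᵥ U)) (sym (·ᵥ-pairs c₁ X))) (trans (sym (++-·ᵥ-++ c₁ c₂ (pairs X) U)) c·C≡y)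
        [a⊕b]W≡0 : (a ⊕ b) ·ᵥ W ≡ zeroV
        [a⊕b]W≡0 = begin
          (a ⊕ b) ·ᵥ W                                              ≡⟨ sym (A+I-pair a b X) ⟩
          A+I ((a ·ᵥ X) ⊕ (b ·ᵥ XA))                                ≡⟨ sym (⊕-identityʳ _) ⟩
          A+I ((a ·ᵥ X) ⊕ (b ·ᵥ XA)) ⊕ zeroV                        ≡⟨ cong (A+I ((a ·ᵥ X) ⊕ (b ·ᵥ XA)) ⊕_) (sym (fixed-·ᵥ c₂ U fixedU)) ⟩
          A+I ((a ·ᵥ X) ⊕ (b ·ᵥ XA)) ⊕ A+I (c₂ ·ᵥ U)                ≡⟨ sym (A+I-⊕ _ _) ⟩
          A+I (((a ·ᵥ X) ⊕ (b ·ᵥ XA)) ⊕ (c₂ ·ᵥ U))                  ≡⟨ cong A+I y≡ ⟩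
          A+I y                                                     ≡⟨ A+Iy≡0 ⟩
          zeroV ∎
          where open ≡-Reasoning
        a≡b : a ≡ b
        a≡b = ⊕≡0⇒≡ a b (indepX (a ⊕ b) [a⊕b]W≡0)
        a·B≡y : (a ++ c₂) ·ᵥ B ≡ y
        a·B≡y = trans (++-·ᵥ-++ a c₂ W U) (trans (cong (_⊕ (c₂ ·ᵥ U))
                  (trans (·ᵥ-map-A+I a X) (trans (⊕-comm _ _) (cong (λ t → (a ·ᵥ X) ⊕ (t ·ᵥ XA)) a≡b)))) y≡)

      inSpan-B≡isFixed : ∀ y → inSpan B y ≡ isFixed y
      inSpan-B≡isFixed y = ≡true-ext _ _
        (λ e → let (c , c·B≡y) = inSpan⇒·ᵥ B y e in A+I≡0⇒isFixed y (trans (cong A+I (sym c·B≡y)) (B-fixed c)))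
        (λ e → fixed⇒inSpan-B y (isFixed⇒A+I≡0 y e))

      count-isFixed : Count.count v isFixed ≡ 2 ^ (s + m)
      count-isFixed = trans (Count.count-cong v isFixed (inSpan B) (λ y → sym (inSpan-B≡isFixed y))) (count-inSpan B B-independent)

·ₘ-cancelʳ : ∀ {k n} (Q : Mat n) → Independent Q → (M M′ : Vec (Vecᶠ n) k) → map (_·ᵥ Q) M ≡ map (_·ᵥ Q) M′ → M ≡ M′
·ₘ-cancelʳ Q indep [] [] _ = refl
·ₘ-cancelʳ Q indep (x ∷ M) (x′ ∷ M′) eq =
  cong₂ _∷_ (independent-injective Q indep x x′ (proj₁ (∷-injective eq))) (·ₘ-cancelʳ Q indep M M′ (proj₂ (∷-injective eq)))

basis⇒invertible : ∀ {n} (Q : Mat n) → Independent Q → Spanning Q →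
                   Σ (Mat n) λ P → (P ·ₘ Q ≡ idMat) × (Q ·ₘ P ≡ idMat)
basis⇒invertible Q indep spanning = P , PQ≡I , QP≡I
  where
  coordinates : ∀ y → Σ _ λ c → c ·ᵥ Q ≡ y
  coordinates y = inSpan⇒·ᵥ Q y (spanning y)
  P = map (λ e → proj₁ (coordinates e)) idMat
  PQ≡I : P ·ₘ Q ≡ idMat
  PQ≡I = trans (sym (map-∘ _ _ idMat)) (trans (map-cong (λ e → proj₂ (coordinates e)) idMat) (map-id idMat))
  QP≡I : Q ·ₘ P ≡ idMat
  QP≡I = ·ₘ-cancelʳ Q indep (Q ·ₘ P) idMat (begin
    (Q ·ₘ P) ·ₘ Q ≡⟨ ·ₘ-assoc Q P Q ⟩
    Q ·ₘ (P ·ₘ Q) ≡⟨ cong (Q ·ₘ_) PQ≡I ⟩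
    Q ·ₘ idMat    ≡⟨ ·ₘ-identityʳ Q ⟩
    Q             ≡⟨ sym (idMat-·ᵥ Q) ⟩
    idMat ·ₘ Q ∎)
    where open ≡-Reasoning

<ᵇ-true⇒< : ∀ a b → (a <ᵇ b) ≡ true → a < b
<ᵇ-true⇒< a b e = <ᵇ⇒< a b (Equivalence.from T-≡ e)

<⇒<ᵇ-true : ∀ {a b} → a < b → (a <ᵇ b) ≡ true
<⇒<ᵇ-true a<b = Equivalence.to T-≡ (<⇒<ᵇ a<b)

<ᵇ-false⇒≥ : ∀ a b → (a <ᵇ b) ≡ false → b ≤ a
<ᵇ-false⇒≥ a b e = ≮⇒≥ (λ a<b → false≢true (trans (sym e) (<⇒<ᵇ-true a<b)))

≡ᵇ-true⇒≡ : ∀ a b → (a ≡ᵇ b) ≡ true → a ≡ b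
≡ᵇ-true⇒≡ a b e = ≡ᵇ⇒≡ a b (Equivalence.from T-≡ e)

≡ᵇ-sym : ∀ a b → (a ≡ᵇ b) ≡ (b ≡ᵇ a)
≡ᵇ-sym zero zero = refl
≡ᵇ-sym zero (suc b) = refl
≡ᵇ-sym (suc a) zero = refl
≡ᵇ-sym (suc a) (suc b) = ≡ᵇ-sym a b

swapPair : ℕ → ℕ
swapPair zero = 1
swapPair (suc zero) = 0
swapPair (suc (suc k)) = suc (suc (swapPair k))

swapPair-< : ∀ i s → i < double s → swapPair i < double s
swapPair-< zero (suc s) _ = s≤s (s≤s z≤n)
swapPair-< (suc zero) (suc s) _ = s≤s z≤n
swapPair-< (suc (suc i)) (suc s) (s≤s (s≤s i<2s)) = s≤s (s≤s (swapPair-< i s i<2s))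

half : ℕ → ℕ
half zero = 0
half (suc zero) = 0
half (suc (suc k)) = suc (half k)

/2≡half : ∀ k → k / 2 ≡ half k
/2≡half zero = refl
/2≡half (suc zero) = refl
/2≡half (suc (suc k)) = trans (m/n≡1+[m∸n]/n {suc (suc k)} {2} (s≤s (s≤s z≤n))) (cong suc (/2≡half k))

sameHalf-distinct≡swapPair : ∀ i j → ((half i ≡ᵇ half j) ∧ not (i ≡ᵇ j)) ≡ (j ≡ᵇ swapPair i)
sameHalf-distinct≡swapPair zero zero = refl
sameHalf-distinct≡swapPair zero (suc zero) = refl
sameHalf-distinct≡swapPair zero (suc (suc j)) = refl
sameHalf-distinct≡swapPair (suc zero) zero = refl
sameHalf-distinct≡swapPair (suc zero) (suc zero) = refl
sameHalf-distinct≡swapPair (suc zero) (suc (suc j)) = refl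
sameHalf-distinct≡swapPair (suc (suc i)) zero = refl
sameHalf-distinct≡swapPair (suc (suc i)) (suc zero) = refl
sameHalf-distinct≡swapPair (suc (suc i)) (suc (suc j)) = sameHalf-distinct≡swapPair i j

partner : ℕ → ℕ → ℕ
partner s i = if i <ᵇ (2 * s) then swapPair i else i

-- The left-hand side is the local function entry of Avs in Defs, which cannot be referred to by name.
Avs-entry : ∀ s i j →
  (if i <ᵇ (2 * s) then ((j <ᵇ (2 * s)) ∧ ((i / 2) ≡ᵇ (j / 2)) ∧ not (i ≡ᵇ j)) else (i ≡ᵇ j)) ≡ (j ≡ᵇ partner s i)
Avs-entry s i j with i <ᵇ (2 * s) in e
... | false = ≡ᵇ-sym i j
... | true = trans (cong ((j <ᵇ 2 * s) ∧_) (trans (cong₂ (λ a b → (a ≡ᵇ b) ∧ not (i ≡ᵇ j)) (/2≡half i) (/2≡half j))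
                                                   (sameHalf-distinct≡swapPair i j)))
                   (j<2s-when-partner (j ≡ᵇ swapPair i) refl)
  where
  swap-i<2s : swapPair i < 2 * s
  swap-i<2s = subst (swapPair i <_) (double≡2* s) (swapPair-< i s (subst (i <_) (sym (double≡2* s)) (<ᵇ-true⇒< i (2 * s) e)))
  j<2s-when-partner : ∀ b → (j ≡ᵇ swapPair i) ≡ b → ((j <ᵇ 2 * s) ∧ b) ≡ b
  j<2s-when-partner false _ = ∧-zeroʳ _
  j<2s-when-partner true p =
    cong (_∧ true) (<⇒<ᵇ-true (subst (_< 2 * s) (sym (≡ᵇ-true⇒≡ j (swapPair i) p)) swap-i<2s))

Avs-row : ∀ v s (i : Fin v) → lookup (Avs v s) i ≡ tabulate (λ j → toℕ j ≡ᵇ partner s (toℕ i))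
Avs-row v s i = trans (lookup∘tabulate _ i) (tabulate-cong (λ j → Avs-entry s (toℕ i) (toℕ j)))

nth : ∀ {w k} → ℕ → Vec (Vecᶠ w) k → Vecᶠ w
nth _ [] = zeroV
nth zero (x ∷ xs) = x
nth (suc n) (x ∷ xs) = nth n xs

lookup≡nth : ∀ {w k} (xs : Vec (Vecᶠ w) k) (i : Fin k) → lookup xs i ≡ nth (toℕ i) xs
lookup≡nth (x ∷ xs) Fin.zero = refl
lookup≡nth (x ∷ xs) (Fin.suc i) = lookup≡nth xs i

nth-++ˡ : ∀ {w a b} (P : Vec (Vecᶠ w) a) (U : Vec (Vecᶠ w) b) k → k < a → nth k (P ++ U) ≡ nth k P
nth-++ˡ (x ∷ P) U zero _ = refl
nth-++ˡ (x ∷ P) U (suc k) (s≤s k<a) = nth-++ˡ P U k k<a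

nth-++ʳ : ∀ {w a b} (P : Vec (Vecᶠ w) a) (U : Vec (Vecᶠ w) b) j → nth (a + j) (P ++ U) ≡ nth j U
nth-++ʳ [] U j = refl
nth-++ʳ (x ∷ P) U j = nth-++ʳ P U j

unitRow-·ᵥ : ∀ {w n} (t : ℕ) (M : Vec (Vecᶠ w) n) → tabulate (λ (j : Fin n) → toℕ j ≡ᵇ t) ·ᵥ M ≡ nth t M
unitRow-·ᵥ t [] = refl
unitRow-·ᵥ zero (r ∷ M) =
  trans (cong (scale true r ⊕_) (trans (cong (_·ᵥ M) (allFalse _)) (·ᵥ-zeroˡ M))) (trans (⊕-identityʳ _) (scale-true r))
  where
  allFalse : ∀ n → tabulate {n} (λ _ → false) ≡ zeroV
  allFalse zero = refl
  allFalse (suc n) = cong (false ∷_) (allFalse n)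
unitRow-·ᵥ (suc t) (r ∷ M) =
  trans (cong (_⊕ (tabulate (λ j → toℕ j ≡ᵇ t) ·ᵥ M)) (scale-false r)) (trans (⊕-identityˡ _) (unitRow-·ᵥ t M))

nth-inSpan : ∀ {w n} i (b : Vec (Vecᶠ w) n) → inSpan b (nth i b) ≡ true
nth-inSpan i b = subst (λ t → inSpan b t ≡ true) (unitRow-·ᵥ i b) (inSpan-·ᵥ b (tabulate (λ j → toℕ j ≡ᵇ i)))

module InvolutionBasis {n : ℕ} (A : Mat n) (A²≡I : A ·ₘ A ≡ idMat) where
  open Involution A A²≡I

  pairs-·A : ∀ {s} (X : Vec (Vecᶠ n) s) k → k < double s → nth k (pairs X) ·ᵥ A ≡ nth (swapPair k) (pairs X)
  pairs-·A (x ∷ X) zero _ = refl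
  pairs-·A (x ∷ X) (suc zero) _ = ·A-involutive x
  pairs-·A (x ∷ X) (suc (suc k)) (s≤s (s≤s k<2s)) = pairs-·A X k k<2s

  fixed-·A : ∀ {m} (U : Vec (Vecᶠ n) m) → All-fixed U → ∀ j → nth j U ·ᵥ A ≡ nth j U
  fixed-·A [] _ j = ·ᵥ-zeroˡ A
  fixed-·A (u ∷ U) fixed zero = ⊕≡0⇒≡ _ _ (proj₁ (∷-injective fixed))
  fixed-·A (u ∷ U) fixed (suc j) = fixed-·A U (proj₂ (∷-injective fixed)) j

  basis-·A : ∀ {s m} (X : Vec (Vecᶠ n) s) (U : Vec (Vecᶠ n) m) → All-fixed U → ∀ k →
             nth k (pairs X ++ U) ·ᵥ A ≡ nth (partner s k) (pairs X ++ U)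
  basis-·A {s} {m} X U fixed k with k <ᵇ (2 * s) in e
  ... | true = begin
      nth k (pairs X ++ U) ·ᵥ A         ≡⟨ cong (_·ᵥ A) (nth-++ˡ (pairs X) U k k<2s) ⟩
      nth k (pairs X) ·ᵥ A              ≡⟨ pairs-·A X k k<2s ⟩
      nth (swapPair k) (pairs X)        ≡⟨ sym (nth-++ˡ (pairs X) U (swapPair k) (swapPair-< k s k<2s)) ⟩
      nth (swapPair k) (pairs X ++ U) ∎
    where
    open ≡-Reasoning
    k<2s : k < double s
    k<2s = subst (k <_) (sym (double≡2* s)) (<ᵇ-true⇒< k (2 * s) e)
  ... | false = begin
      nth k (pairs X ++ U) ·ᵥ A                ≡⟨ cong (λ t → nth t (pairs X ++ U) ·ᵥ A) (sym k≡) ⟩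
      nth (double s + j) (pairs X ++ U) ·ᵥ A   ≡⟨ cong (_·ᵥ A) (nth-++ʳ (pairs X) U j) ⟩
      nth j U ·ᵥ A                             ≡⟨ fixed-·A U fixed j ⟩
      nth j U                                  ≡⟨ sym (nth-++ʳ (pairs X) U j) ⟩
      nth (double s + j) (pairs X ++ U)        ≡⟨ cong (λ t → nth t (pairs X ++ U)) k≡ ⟩
      nth k (pairs X ++ U) ∎
    where
    open ≡-Reasoning
    j = k ∸ double s
    k≡ : double s + j ≡ k
    k≡ = m+[n∸m]≡n (subst (_≤ k) (sym (double≡2* s)) (<ᵇ-false⇒≥ k (2 * s) e))

conjugate-Avs : ∀ s m (A : Mat (double s + m)) (A²≡I : A ·ₘ A ≡ idMat) (X : Vec (Vecᶠ (double s + m)) s)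
                (U : Vec (Vecᶠ (double s + m)) m) → Involution.All-fixed A A²≡I U →
                Independent (Involution.pairs A A²≡I X ++ U) → Spanning (Involution.pairs A A²≡I X ++ U) →
                Conjugate A (Avs (double s + m) s)
conjugate-Avs s m A A²≡I X U fixed indep spanning = P , Q , PQ≡I , QP≡I , QAP≡Avs
  where
  open Involution A A²≡I
  open InvolutionBasis A A²≡I
  Q = pairs X ++ U
  inverse = basis⇒invertible Q indep spanning
  P = proj₁ inverse
  PQ≡I = proj₁ (proj₂ inverse)
  QP≡I = proj₂ (proj₂ inverse)
  QA≡AvsQ : Q ·ₘ A ≡ Avs (double s + m) s ·ₘ Q
  QA≡AvsQ = begin
    map (_·ᵥ A) Q                                           ≡⟨ cong (map (_·ᵥ A)) (sym (tabulate∘lookup Q)) ⟩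
    map (_·ᵥ A) (tabulate (lookup Q))                       ≡⟨ sym (tabulate-∘ _ _) ⟩
    tabulate (λ i → lookup Q i ·ᵥ A)                        ≡⟨ tabulate-cong row ⟩
    tabulate (λ i → lookup (Avs _ s) i ·ᵥ Q)                ≡⟨ tabulate-∘ _ _ ⟩
    map (_·ᵥ Q) (tabulate (lookup (Avs _ s)))               ≡⟨ cong (map (_·ᵥ Q)) (tabulate∘lookup _) ⟩
    map (_·ᵥ Q) (Avs _ s) ∎
    where
    open ≡-Reasoning
    row : ∀ i → lookup Q i ·ᵥ A ≡ lookup (Avs _ s) i ·ᵥ Q
    row i = begin
      lookup Q i ·ᵥ A                                         ≡⟨ cong (_·ᵥ A) (lookup≡nth Q i) ⟩
      nth (toℕ i) Q ·ᵥ A                                      ≡⟨ basis-·A X U fixed (toℕ i) ⟩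
      nth (partner s (toℕ i)) Q                               ≡⟨ sym (unitRow-·ᵥ (partner s (toℕ i)) Q) ⟩
      tabulate (λ j → toℕ j ≡ᵇ partner s (toℕ i)) ·ᵥ Q        ≡⟨ cong (_·ᵥ Q) (sym (Avs-row _ s i)) ⟩
      lookup (Avs _ s) i ·ᵥ Q ∎
  QAP≡Avs : (Q ·ₘ A) ·ₘ P ≡ Avs (double s + m) s
  QAP≡Avs = begin
    (Q ·ₘ A) ·ₘ P            ≡⟨ cong (_·ₘ P) QA≡AvsQ ⟩
    (Avs _ s ·ₘ Q) ·ₘ P      ≡⟨ ·ₘ-assoc _ Q P ⟩
    Avs _ s ·ₘ (Q ·ₘ P)      ≡⟨ cong (Avs _ s ·ₘ_) QP≡I ⟩
    Avs _ s ·ₘ idMat         ≡⟨ ·ₘ-identityʳ _ ⟩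
    Avs _ s ∎
    where open ≡-Reasoning

NormalForm : ∀ {v} (A : Mat v) (A²≡I : A ·ₘ A ≡ idMat) → Set
NormalForm {v} A A²≡I = Σ ℕ λ s → Σ ℕ λ m →
  (double s + m ≡ v) × (1 ≤ s) × Conjugate A (Avs v s) × (Count.count v (Involution.isFixed A A²≡I) ≡ 2 ^ (s + m))

involution-normalForm : ∀ {v} (A : Mat v) (A²≡I : A ·ₘ A ≡ idMat) → A ≢ idMat → NormalForm A A²≡I
involution-normalForm {v} A A²≡I A≢I with Involution.imageBasis A A²≡I
... | s , X , indepX , spansX with Involution.Completion.completed A A²≡I X indepX spansX
... | m , U , fixed , indep , spanning =
  s , m , dim , imageBasis-nonempty X spansX , conjugate , Completion.FixedSpace.count-isFixed X indepX spansX U fixed indep spanning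
  where
  open Involution A A²≡I
  dim : double s + m ≡ v
  dim = ≤-antisym (independent⇒≤ (pairs X ++ U) indep) (spanning⇒≥ (pairs X ++ U) spanning)
  conjugate : Conjugate A (Avs v s)
  conjugate with dim
  ... | refl = conjugate-Avs s m A A²≡I X U fixed indep spanning
  imageBasis-nonempty : ∀ {s} (X : Vec (Vecᶠ v) s) → SpansImage X → 1 ≤ s
  imageBasis-nonempty (x ∷ X) _ = s≤s z≤n
  imageBasis-nonempty [] spans = ⊥-elim (A≢I (trans (sym (idMat-·ᵥ A)) (trans (map-cong fixed-everywhere idMat) (map-id idMat))))
    where
    fixed-everywhere : ∀ y → y ·ᵥ A ≡ y
    fixed-everywhere y = ⊕≡0⇒≡ _ _ (sym (proj₂ (inSpan⇒·ᵥ [] (A+I y) (spans y))))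

-- Three-dimensional spaces over F₂

nonzero : ∀ {n} → Vecᶠ n → Bool
nonzero x = not (x ==ᵥ zeroV)

nonzero⇒≢0 : ∀ {n} (x : Vecᶠ n) → nonzero x ≡ true → x ≢ zeroV
nonzero⇒≢0 {n} x e refl = false≢true (trans (sym (cong not (==ᵥ-refl (zeroV {n})))) e)

independentPair : ∀ {n} → Vecᶠ n → Vecᶠ n → Bool
independentPair x y = nonzero x ∧ nonzero y ∧ not (x ==ᵥ y)

independentPair⇒Independent : ∀ {n} (x y : Vecᶠ n) → independentPair x y ≡ true → Independent (x ∷ y ∷ [])
independentPair⇒Independent x y e (false ∷ false ∷ []) _ = refl
independentPair⇒Independent x y e (true ∷ false ∷ []) x≡0 =
  ⊥-elim (nonzero⇒≢0 x (∧-elimˡ _ e) (trans (sym (unitRow-·ᵥ 0 (x ∷ y ∷ []))) x≡0))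
independentPair⇒Independent x y e (false ∷ true ∷ []) y≡0 =
  ⊥-elim (nonzero⇒≢0 y (∧-elimˡ _ (∧-elimʳ (nonzero x) e)) (trans (sym (unitRow-·ᵥ 1 (x ∷ y ∷ []))) y≡0))
independentPair⇒Independent x y e (true ∷ true ∷ []) x⊕y≡0 =
  ⊥-elim (false≢true (trans (sym (cong not x==y)) (∧-elimʳ (nonzero y) (∧-elimʳ (nonzero x) e))))
  where
  x⊕y≡ : (true ∷ true ∷ []) ·ᵥ (x ∷ y ∷ []) ≡ x ⊕ y
  x⊕y≡ = trans (·ᵥ-distribʳ-⊕ (true ∷ false ∷ []) (false ∷ true ∷ []) (x ∷ y ∷ []))
               (cong₂ _⊕_ (unitRow-·ᵥ 0 (x ∷ y ∷ [])) (unitRow-·ᵥ 1 (x ∷ y ∷ [])))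
  x==y : x ==ᵥ y ≡ true
  x==y = subst (λ t → x ==ᵥ t ≡ true) (⊕≡0⇒≡ x y (trans (sym x⊕y≡) x⊕y≡0)) (==ᵥ-refl x)

allᵥ : ∀ m → (Vecᶠ m → Bool) → Bool
allᵥ zero P = P []
allᵥ (suc m) P = allᵥ m (λ c → P (true ∷ c)) ∧ allᵥ m (λ c → P (false ∷ c))

allᵥ-sound : ∀ m P → allᵥ m P ≡ true → ∀ c → P c ≡ true
allᵥ-sound zero P e [] = e
allᵥ-sound (suc m) P e (true ∷ c) = allᵥ-sound m _ (∧-elimˡ _ e) c
allᵥ-sound (suc m) P e (false ∷ c) = allᵥ-sound m _ (∧-elimʳ (allᵥ m (λ c → P (true ∷ c))) e) c

allᵥ-sound² : ∀ m k (P : Vecᶠ m → Vecᶠ k → Bool) → allᵥ m (λ a → allᵥ k (P a)) ≡ true → ∀ a b → P a b ≡ true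
allᵥ-sound² m k P e a = allᵥ-sound k (P a) (allᵥ-sound m (λ a → allᵥ k (P a)) e a)

_⇒ᵇ_ : Bool → Bool → Bool
a ⇒ᵇ b = not a ∨ b

⇒ᵇ-elim : ∀ {a b} → (a ⇒ᵇ b) ≡ true → a ≡ true → b ≡ true
⇒ᵇ-elim e refl = e

plane-complement-in-F₂³ : ∀ (p q : Vecᶠ 3) → independentPair p q ≡ true →
                          ∑ 3 (λ c → 𝟙 (not (inSpan (p ∷ q ∷ []) c))) ≡ 4
plane-complement-in-F₂³ p q pq = ≡ᵇ-true⇒≡ _ 4 (⇒ᵇ-elim (allᵥ-sound² 3 3 check refl p q) pq)
  where
  check : Vecᶠ 3 → Vecᶠ 3 → Bool
  check p q = independentPair p q ⇒ᵇ (∑ 3 (λ c → 𝟙 (not (inSpan (p ∷ q ∷ []) c))) ≡ᵇ 4)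

isZero₃ : ∀ {n} → Vec (Vecᶠ n) 3 → Bool
isZero₃ (a ∷ b ∷ c ∷ []) = (a ==ᵥ zeroV) ∧ (b ==ᵥ zeroV) ∧ (c ==ᵥ zeroV)

square-zero-kernel-in-F₂³ : ∀ (M : Vec (Vecᶠ 3) 3) → isZero₃ (map (_·ᵥ M) M) ≡ true → isZero₃ M ≡ false →
                            ∑ 3 (λ c → 𝟙 (((c ·ᵥ M) ==ᵥ zeroV) ∧ nonzero c)) ≡ 3
square-zero-kernel-in-F₂³ M@(a ∷ b ∷ c ∷ []) M²≡0 M≢0 =
  ≡ᵇ-true⇒≡ _ 3 (⇒ᵇ-elim (allᵥ-sound 3 (λ c → check (a ∷ b ∷ c ∷ []))
                            (allᵥ-sound² 3 3 (λ a b → allᵥ 3 (λ c → check (a ∷ b ∷ c ∷ []))) refl a b) c)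
                         (∧-intro M²≡0 (cong not M≢0)))
  where
  check : Vec (Vecᶠ 3) 3 → Bool
  check M = (isZero₃ (map (_·ᵥ M) M) ∧ not (isZero₃ M)) ⇒ᵇ (∑ 3 (λ c → 𝟙 (((c ·ᵥ M) ==ᵥ zeroV) ∧ nonzero c)) ≡ᵇ 3)

count-within-span : ∀ {n k} (b : Vec (Vecᶠ n) k) → Independent b → (P : Vecᶠ n → Bool) →
                    (∀ y → P y ≡ true → inSpan b y ≡ true) → Count.count n P ≡ Count.count k (λ c → P (c ·ᵥ b))
count-within-span {n} {k} b indep P P⊆span = begin
  ∑ n (λ y → 𝟙 (P y))                                          ≡⟨ Count.sum-cong n _ _ 𝟙P≡𝟙P*fibre ⟩
  ∑ n (λ y → 𝟙 (P y) * fibreSize y)                            ≡⟨ Count.sum-cong n _ _ (λ y → sym (Count.sum-*ˡ k (𝟙 (P y)) _)) ⟩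
  ∑ n (λ y → ∑ k (λ c → 𝟙 (P y) * 𝟙 ((c ·ᵥ b) ==ᵥ y)))          ≡⟨ Count.sum-swap n (Vecᶠ k) (∑ k) (∑-additive k) _ ⟩
  ∑ k (λ c → ∑ n (λ y → 𝟙 (P y) * 𝟙 ((c ·ᵥ b) ==ᵥ y)))
    ≡⟨ Count.sum-cong k _ _ (λ c → trans (Count.sum-cong n _ _ (product≡if c)) (Count.sum-delta n (c ·ᵥ b) _)) ⟩
  ∑ k (λ c → 𝟙 (P (c ·ᵥ b))) ∎
  where
  open ≡-Reasoning
  open Image (_·ᵥ b) using (fibreSize)
  𝟙P≡𝟙P*fibre : ∀ y → 𝟙 (P y) ≡ 𝟙 (P y) * fibreSize y
  𝟙P≡𝟙P*fibre y with P y in e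
  ... | false = refl
  ... | true = trans (trans (cong 𝟙 (sym (P⊆span y e))) (Image.Injective.𝟙-inImage≡fibreSize (_·ᵥ b) (independent-injective b indep) y))
                     (sym (+-identityʳ _))
  product≡if : ∀ c y → 𝟙 (P y) * 𝟙 ((c ·ᵥ b) ==ᵥ y) ≡ (if y ==ᵥ (c ·ᵥ b) then 𝟙 (P y) else 0)
  product≡if c y rewrite Count.==-sym n (c ·ᵥ b) y with y ==ᵥ (c ·ᵥ b)
  ... | true = *-identityʳ _
  ... | false = *-zeroʳ (𝟙 (P y))

inSpan-coordinates : ∀ {n k j} (b : Vec (Vecᶠ n) k) → Independent b → (cs : Vec (Vecᶠ k) j) → ∀ c →
                     inSpan (map (_·ᵥ b) cs) (c ·ᵥ b) ≡ inSpan cs c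
inSpan-coordinates b indep cs c = ≡true-ext _ _
  (λ e → let (a , p) = inSpan⇒·ᵥ (map (_·ᵥ b) cs) (c ·ᵥ b) e in
         subst (λ t → inSpan cs t ≡ true) (independent-injective b indep _ _ (trans (sym (·ᵥ-assoc a cs b)) p)) (inSpan-·ᵥ cs a))
  (λ e → let (a , p) = inSpan⇒·ᵥ cs c e in
         subst (λ t → inSpan (map (_·ᵥ b) cs) t ≡ true) (trans (·ᵥ-assoc a cs b) (cong (_·ᵥ b) p)) (inSpan-·ᵥ (map (_·ᵥ b) cs) a))

==ᵥ-coordinates : ∀ {n k} (b : Vec (Vecᶠ n) k) → Independent b → ∀ c c′ → (c ·ᵥ b) ==ᵥ (c′ ·ᵥ b) ≡ c ==ᵥ c′
==ᵥ-coordinates b indep c c′ = ≡true-ext _ _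
  (λ e → subst (λ t → c ==ᵥ t ≡ true) (independent-injective b indep c c′ (==ᵥ-sound _ _ e)) (==ᵥ-refl c))
  (λ e → subst (λ t → (c ·ᵥ b) ==ᵥ (t ·ᵥ b) ≡ true) (==ᵥ-sound c c′ e) (==ᵥ-refl (c ·ᵥ b)))

nonzero-coordinates : ∀ {n k} (b : Vec (Vecᶠ n) k) → Independent b → ∀ c → nonzero (c ·ᵥ b) ≡ nonzero c
nonzero-coordinates b indep c = cong not (trans (cong ((c ·ᵥ b) ==ᵥ_) (sym (·ᵥ-zeroˡ b))) (==ᵥ-coordinates b indep c zeroV))

count-ordered-pairs : ∀ n (P : Vecᶠ n → Bool) →
                      ∑ n (λ p → ∑ n (λ q → 𝟙 (P p ∧ P q ∧ not (p ==ᵥ q)))) ≡ Count.count n P * (Count.count n P ∸ 1)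
count-ordered-pairs n P = trans (Count.sum-cong n _ _ others) (Count.sum-*ʳ n _ (λ p → 𝟙 (P p)))
  where
  k = Count.count n P
  others : ∀ p → ∑ n (λ q → 𝟙 (P p ∧ P q ∧ not (p ==ᵥ q))) ≡ 𝟙 (P p) * (k ∸ 1)
  others p with P p in Pp
  ... | false = Count.sum-0 n
  ... | true = begin
    Count.count n (λ q → P q ∧ not (p ==ᵥ q))
      ≡⟨ Count.count-cong n _ _ (λ q → cong (λ t → P q ∧ not t) (Count.==-sym n p q)) ⟩
    Count.count n (λ q → P q ∧ not (q ==ᵥ p))                                   ≡⟨ sym (cong (_∸ 1) split) ⟩
    k ∸ 1                                                                       ≡⟨ sym (+-identityʳ _) ⟩
    1 * (k ∸ 1) ∎
    where
    open ≡-Reasoning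
    P∧=p : ∀ q → (P q ∧ (q ==ᵥ p)) ≡ (q ==ᵥ p)
    P∧=p q with q ==ᵥ p in e
    ... | false = ∧-zeroʳ _
    ... | true = cong (_∧ true) (trans (cong P (==ᵥ-sound q p e)) Pp)
    split : k ≡ 1 + Count.count n (λ q → P q ∧ not (q ==ᵥ p))
    split = trans (Count.count-split n P (_==ᵥ p))
                  (cong (_+ Count.count n (λ q → P q ∧ not (q ==ᵥ p))) (trans (Count.count-cong n _ _ P∧=p) (Count.count-singleton n p)))

independentPair-coordinates : ∀ {n k} (b : Vec (Vecᶠ n) k) → Independent b → ∀ c c′ →
                              independentPair (c ·ᵥ b) (c′ ·ᵥ b) ≡ independentPair c c′
independentPair-coordinates b indep c c′ =
  cong₂ _∧_ (nonzero-coordinates b indep c) (cong₂ _∧_ (nonzero-coordinates b indep c′) (cong not (==ᵥ-coordinates b indep c c′)))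

plane-complement-count : ∀ {n} (b : Vec (Vecᶠ n) 3) → Independent b → ∀ p q →
  inSpan b p ≡ true → inSpan b q ≡ true → independentPair p q ≡ true →
  Count.count n (λ r → inSpan b r ∧ not (inSpan (p ∷ q ∷ []) r)) ≡ 4
plane-complement-count {n} b indep p q p∈b q∈b pq = begin
  Count.count n (λ r → inSpan b r ∧ not (inSpan (p ∷ q ∷ []) r))            ≡⟨ count-within-span b indep _ (λ y e → ∧-elimˡ (inSpan b y) e) ⟩
  Count.count 3 (λ c → inSpan b (c ·ᵥ b) ∧ not (inSpan (p ∷ q ∷ []) (c ·ᵥ b))) ≡⟨ Count.count-cong 3 _ _ inCoordinates ⟩
  Count.count 3 (λ c → not (inSpan (cp ∷ cq ∷ []) c))                        ≡⟨ plane-complement-in-F₂³ cp cq cpcq ⟩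
  4 ∎
  where
  open ≡-Reasoning
  cp = proj₁ (inSpan⇒·ᵥ b p p∈b)
  cq = proj₁ (inSpan⇒·ᵥ b q q∈b)
  pq≡ : map (_·ᵥ b) (cp ∷ cq ∷ []) ≡ p ∷ q ∷ []
  pq≡ = cong₂ _∷_ (proj₂ (inSpan⇒·ᵥ b p p∈b)) (cong (_∷ []) (proj₂ (inSpan⇒·ᵥ b q q∈b)))
  inCoordinates : ∀ c → (inSpan b (c ·ᵥ b) ∧ not (inSpan (p ∷ q ∷ []) (c ·ᵥ b))) ≡ not (inSpan (cp ∷ cq ∷ []) c)
  inCoordinates c = trans (cong (_∧ not (inSpan (p ∷ q ∷ []) (c ·ᵥ b))) (inSpan-·ᵥ b c))
    (cong not (trans (cong (λ f → inSpan f (c ·ᵥ b)) (sym pq≡)) (inSpan-coordinates b indep (cp ∷ cq ∷ []) c)))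
  cpcq : independentPair cp cq ≡ true
  cpcq = trans (sym (independentPair-coordinates b indep cp cq))
               (subst₂ (λ x y → independentPair x y ≡ true) (sym (proj₂ (inSpan⇒·ᵥ b p p∈b))) (sym (proj₂ (inSpan⇒·ᵥ b q q∈b))) pq)

isZero₃-sound : ∀ {n} (M : Vec (Vecᶠ n) 3) → isZero₃ M ≡ true → M ≡ replicate 3 zeroV
isZero₃-sound (a ∷ b ∷ c ∷ []) e =
  cong₂ _∷_ (==ᵥ-sound a zeroV (∧-elimˡ _ e)) (cong₂ _∷_ (==ᵥ-sound b zeroV (∧-elimˡ _ (∧-elimʳ (a ==ᵥ zeroV) e)))
    (cong (_∷ []) (==ᵥ-sound c zeroV (∧-elimʳ (b ==ᵥ zeroV) (∧-elimʳ (a ==ᵥ zeroV) e)))))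

isZero₃-zeroV : ∀ {n} (a b c : Vecᶠ n) → a ≡ zeroV → b ≡ zeroV → c ≡ zeroV → isZero₃ (a ∷ b ∷ c ∷ []) ≡ true
isZero₃-zeroV {n} _ _ _ refl refl refl = ∧-intro (==ᵥ-refl (zeroV {n})) (∧-intro (==ᵥ-refl (zeroV {n})) (==ᵥ-refl (zeroV {n})))

module InvolutionOnInvariant3Space {n : ℕ} (A : Mat n) (A²≡I : A ·ₘ A ≡ idMat) where
  open Involution A A²≡I

  A+I-matrix : ∀ (b : Vec (Vecᶠ n) 3) → (∀ z → inSpan b z ≡ true → inSpan b (z ·ᵥ A) ≡ true) →
               Σ (Vec (Vecᶠ 3) 3) λ M → map A+I b ≡ map (_·ᵥ b) M
  A+I-matrix b@(b₁ ∷ b₂ ∷ b₃ ∷ []) closed =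
    proj₁ r₁ ∷ proj₁ r₂ ∷ proj₁ r₃ ∷ [] , cong₂ _∷_ (sym (proj₂ r₁)) (cong₂ _∷_ (sym (proj₂ r₂)) (cong (_∷ []) (sym (proj₂ r₃))))
    where
    A+I-coordinates : ∀ i → Σ (Vecᶠ 3) λ m → m ·ᵥ b ≡ A+I (nth i b)
    A+I-coordinates i = inSpan⇒·ᵥ b _ (inSpan-⊕ b _ _ (closed _ (nth-inSpan i b)) (nth-inSpan i b))
    r₁ = A+I-coordinates 0
    r₂ = A+I-coordinates 1
    r₃ = A+I-coordinates 2

  module _ (b : Vec (Vecᶠ n) 3) (indep : Independent b) (M : Vec (Vecᶠ 3) 3) (A+Ib≡Mb : map A+I b ≡ map (_·ᵥ b) M) where

    A+I-in-coordinates : ∀ c → A+I (c ·ᵥ b) ≡ (c ·ᵥ M) ·ᵥ b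
    A+I-in-coordinates c = trans (A+I-·ᵥ c b) (trans (cong (c ·ᵥ_) A+Ib≡Mb) (·ᵥ-assoc c M b))

    isFixed-in-coordinates : ∀ c → isFixed (c ·ᵥ b) ≡ (c ·ᵥ M) ==ᵥ zeroV
    isFixed-in-coordinates c = trans (cong (_==ᵥ zeroV) (A+I-in-coordinates c))
      (trans (cong (((c ·ᵥ M) ·ᵥ b) ==ᵥ_) (sym (·ᵥ-zeroˡ b))) (==ᵥ-coordinates b indep (c ·ᵥ M) zeroV))

    rows-square-zero : ∀ {k} (rows : Vec (Vecᶠ 3) k) (xs : Vec (Vecᶠ n) k) →
                       map (_·ᵥ b) rows ≡ map A+I xs → map (_·ᵥ M) rows ≡ replicate k zeroV
    rows-square-zero [] [] _ = refl
    rows-square-zero (r ∷ rows) (x ∷ xs) eq = cong₂ _∷_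
      (indep (r ·ᵥ M) (trans (sym (A+I-in-coordinates r)) (trans (cong A+I (proj₁ (∷-injective eq))) (A+I-nilpotent x))))
      (rows-square-zero rows xs (proj₂ (∷-injective eq)))

    A+I-matrix-square-zero : isZero₃ (map (_·ᵥ M) M) ≡ true
    A+I-matrix-square-zero = subst (λ t → isZero₃ t ≡ true) (sym (rows-square-zero M b (sym A+Ib≡Mb)))
                                   (isZero₃-zeroV (zeroV {3}) zeroV zeroV refl refl refl)

    A+I-matrix-nonzero : ∀ u → inSpan b u ≡ true → isFixed u ≡ false → isZero₃ M ≡ false
    A+I-matrix-nonzero u u∈b u-moved with isZero₃ M in e
    ... | false = refl
    ... | true = ⊥-elim (false≢true (trans (sym u-moved) (A+I≡0⇒isFixed u A+Iu≡0)))
      where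
      c = proj₁ (inSpan⇒·ᵥ b u u∈b)
      A+Iu≡0 : A+I u ≡ zeroV
      A+Iu≡0 = begin
        A+I u                                   ≡⟨ cong A+I (sym (proj₂ (inSpan⇒·ᵥ b u u∈b))) ⟩
        A+I (c ·ᵥ b)                            ≡⟨ A+I-in-coordinates c ⟩
        (c ·ᵥ M) ·ᵥ b                           ≡⟨ cong (λ t → (c ·ᵥ t) ·ᵥ b) (isZero₃-sound M e) ⟩
        (c ·ᵥ replicate 3 zeroV) ·ᵥ b           ≡⟨ cong (_·ᵥ b) (·ᵥ-zeroʳ c) ⟩
        zeroV ·ᵥ b                              ≡⟨ ·ᵥ-zeroˡ b ⟩
        zeroV ∎
        where open ≡-Reasoning

  fixed-count-in-invariant-3space :
    ∀ (b : Vec (Vecᶠ n) 3) → Independent b → (∀ z → inSpan b z ≡ true → inSpan b (z ·ᵥ A) ≡ true) →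
    ∀ u → inSpan b u ≡ true → isFixed u ≡ false →
    Count.count n (λ p → isFixed p ∧ nonzero p ∧ inSpan b p) ≡ 3
  fixed-count-in-invariant-3space b indep closed u u∈b u-moved = begin
    Count.count n (λ p → isFixed p ∧ nonzero p ∧ inSpan b p)
      ≡⟨ count-within-span b indep _ (λ y e → ∧-elimʳ (nonzero y) (∧-elimʳ (isFixed y) e)) ⟩
    Count.count 3 (λ c → isFixed (c ·ᵥ b) ∧ nonzero (c ·ᵥ b) ∧ inSpan b (c ·ᵥ b))
      ≡⟨ Count.count-cong 3 _ _ inCoordinates ⟩
    Count.count 3 (λ c → ((c ·ᵥ M) ==ᵥ zeroV) ∧ nonzero c)
      ≡⟨ square-zero-kernel-in-F₂³ M (A+I-matrix-square-zero b indep M A+Ib≡Mb) (A+I-matrix-nonzero b indep M A+Ib≡Mb u u∈b u-moved) ⟩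
    3 ∎
    where
    open ≡-Reasoning
    M = proj₁ (A+I-matrix b closed)
    A+Ib≡Mb = proj₂ (A+I-matrix b closed)
    inCoordinates : ∀ c → (isFixed (c ·ᵥ b) ∧ nonzero (c ·ᵥ b) ∧ inSpan b (c ·ᵥ b)) ≡ (((c ·ᵥ M) ==ᵥ zeroV) ∧ nonzero c)
    inCoordinates c = cong₂ _∧_ (isFixed-in-coordinates b indep M A+Ib≡Mb c)
      (trans (cong (nonzero (c ·ᵥ b) ∧_) (inSpan-·ᵥ b c)) (trans (∧-identityʳ _) (nonzero-coordinates b indep c)))

-- Blocks of a q-Steiner triple system

module SteinerTripleSystem {v : ℕ} (𝒟 : SetOfSub v) (sts : IsSTS 𝒟) where

  line : Vecᶠ v → Vecᶠ v → Sub v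
  line x y = span (x ∷ y ∷ [])

  line-dim2 : ∀ x y → independentPair x y ≡ true → IsSubspaceDim 2 (line x y)
  line-dim2 x y xy = (x ∷ y ∷ []) , Independent⇒LinIndep _ (independentPair⇒Independent x y xy) , ((λ z p → p) , (λ z p → p))

  inLine⇒inSpan : ∀ x y z → line x y z → inSpan (x ∷ y ∷ []) z ≡ true
  inLine⇒inSpan x y z (c , p) = subst (λ t → inSpan (x ∷ y ∷ []) t ≡ true) (trans (sym (lincomb≡·ᵥ c _)) p) (inSpan-·ᵥ (x ∷ y ∷ []) c)

  inSpan⇒inLine : ∀ x y z → inSpan (x ∷ y ∷ []) z ≡ true → line x y z
  inSpan⇒inLine x y z e = let (c , p) = inSpan⇒·ᵥ (x ∷ y ∷ []) z e in c , trans (lincomb≡·ᵥ c _) p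

  record Block (x y : Vecᶠ v) (basis : Vec (Vecᶠ v) 3) : Set₁ where
    field
      B : Sub v
      B∈𝒟 : B ∈ᴰ 𝒟
      line⊆B : line x y ⊆ B
      independent : Independent basis
      B≐span : B ≐ span basis

  blockOf : ∀ x y → Σ (Vec (Vecᶠ v) 3) λ b → (independentPair x y ≡ true → Block x y b)
  blockOf x y with independentPair x y in xy
  ... | false = replicate 3 zeroV , λ ()
  ... | true = b , λ _ → record { B = B ; B∈𝒟 = B∈𝒟 ; line⊆B = line⊆B
                                ; independent = LinIndep⇒Independent b (proj₁ (proj₂ dim3)) ; B≐span = proj₂ (proj₂ dim3) }
    where
    existence = proj₁ (proj₂ sts (line x y) (line-dim2 x y xy))
    B = proj₁ existence
    B∈𝒟 = proj₁ (proj₂ existence)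
    line⊆B = proj₂ (proj₂ existence)
    dim3 = proj₁ sts B B∈𝒟
    b = proj₁ dim3

  blockBasis : Vecᶠ v → Vecᶠ v → Vec (Vecᶠ v) 3
  blockBasis x y = proj₁ (blockOf x y)

  block : ∀ x y → independentPair x y ≡ true → Block x y (blockBasis x y)
  block x y = proj₂ (blockOf x y)

  inBlock : Vecᶠ v → Vecᶠ v → Vecᶠ v → Bool
  inBlock x y = inSpan (blockBasis x y)

  inBlock⇒∈B : ∀ x y (xy : independentPair x y ≡ true) z → inBlock x y z ≡ true → Block.B (block x y xy) z
  inBlock⇒∈B x y xy z e = let (c , p) = inSpan⇒·ᵥ (blockBasis x y) z e in
    proj₂ (Block.B≐span (block x y xy)) z (c , trans (lincomb≡·ᵥ c _) p)

  ∈B⇒inBlock : ∀ x y (xy : independentPair x y ≡ true) z → Block.B (block x y xy) z → inBlock x y z ≡ true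
  ∈B⇒inBlock x y xy z z∈B = let (c , p) = proj₁ (Block.B≐span (block x y xy)) z z∈B in
    subst (λ t → inBlock x y t ≡ true) (trans (sym (lincomb≡·ᵥ c _)) p) (inSpan-·ᵥ (blockBasis x y) c)

  line⊆block : ∀ x y → independentPair x y ≡ true → ∀ z → inSpan (x ∷ y ∷ []) z ≡ true → inBlock x y z ≡ true
  line⊆block x y xy z e = ∈B⇒inBlock x y xy z (Block.line⊆B (block x y xy) z (inSpan⇒inLine x y z e))

  x∈block : ∀ x y → independentPair x y ≡ true → inBlock x y x ≡ true
  x∈block x y xy = line⊆block x y xy x (nth-inSpan 0 (x ∷ y ∷ []))

  y∈block : ∀ x y → independentPair x y ≡ true → inBlock x y y ≡ true
  y∈block x y xy = line⊆block x y xy y (nth-inSpan 1 (x ∷ y ∷ []))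

  block-unique : ∀ x y x′ y′ → independentPair x y ≡ true → independentPair x′ y′ ≡ true →
                 inBlock x y x′ ≡ true → inBlock x y y′ ≡ true → ∀ z → inBlock x′ y′ z ≡ inBlock x y z
  block-unique x y x′ y′ xy x′y′ x′∈ y′∈ z = ≡true-ext _ _
    (λ e → ∈B⇒inBlock x y xy z (proj₁ same z (inBlock⇒∈B x′ y′ x′y′ z e)))
    (λ e → ∈B⇒inBlock x′ y′ x′y′ z (proj₂ same z (inBlock⇒∈B x y xy z e)))
    where
    Bxy = block x y xy
    Bx′y′ = block x′ y′ x′y′
    cx′ = inSpan⇒·ᵥ (blockBasis x y) x′ x′∈
    cy′ = inSpan⇒·ᵥ (blockBasis x y) y′ y′∈
    line′⊆B : line x′ y′ ⊆ Block.B Bxy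
    line′⊆B t t∈ = inBlock⇒∈B x y xy t (inSpan-⊆ (blockBasis x y) (proj₁ cx′ ∷ proj₁ cy′ ∷ []) t
      (subst (λ f → inSpan f t ≡ true) (sym (cong₂ _∷_ (proj₂ cx′) (cong (_∷ []) (proj₂ cy′)))) (inLine⇒inSpan x′ y′ t t∈)))
    same : Block.B Bx′y′ ≐ Block.B Bxy
    same = proj₂ (proj₂ sts (line x′ y′) (line-dim2 x′ y′ x′y′)) _ _
             (Block.B∈𝒟 Bx′y′) (Block.line⊆B Bx′y′) (Block.B∈𝒟 Bxy) line′⊆B

  block-·A-closed : ∀ (A : Mat v) → A ·ₘ A ≡ idMat → IsAutomorphism 𝒟 A →
                    ∀ x y → independentPair x y ≡ true →
                    inSpan (x ∷ y ∷ []) (x ·ᵥ A) ≡ true → inSpan (x ∷ y ∷ []) (y ·ᵥ A) ≡ true →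
                    ∀ z → inBlock x y z ≡ true → inBlock x y (z ·ᵥ A) ≡ true
  block-·A-closed A A²≡I aut x y xy xA∈ yA∈ z z∈ =
    ∈B⇒inBlock x y xy (z ·ᵥ A) (proj₂ B≐BA (z ·ᵥ A) (z , inBlock⇒∈B x y xy z z∈ , refl))
    where
    open Involution A A²≡I using (·A-involutive)
    Bxy = block x y xy
    B = Block.B Bxy
    cxA = inSpan⇒·ᵥ (x ∷ y ∷ []) (x ·ᵥ A) xA∈
    cyA = inSpan⇒·ᵥ (x ∷ y ∷ []) (y ·ᵥ A) yA∈
    line-·A : ∀ t → line x y t → line x y (t ·ᵥ A)
    line-·A t (c , p) = inSpan⇒inLine x y (t ·ᵥ A) (inSpan-⊆ (x ∷ y ∷ []) (proj₁ cxA ∷ proj₁ cyA ∷ []) (t ·ᵥ A)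
      (subst (λ f → inSpan f (t ·ᵥ A) ≡ true) (sym (cong₂ _∷_ (proj₂ cxA) (cong (_∷ []) (proj₂ cyA))))
        (subst (λ s → inSpan ((x ·ᵥ A) ∷ (y ·ᵥ A) ∷ []) s ≡ true)
          (trans (·ᵥ-assoc c (x ∷ y ∷ []) A) (cong (_·ᵥ A) (trans (sym (lincomb≡·ᵥ c _)) p))) (inSpan-·ᵥ ((x ·ᵥ A) ∷ (y ·ᵥ A) ∷ []) c))))
    line⊆BA : line x y ⊆ (B ·ˢ A)
    line⊆BA t t∈ = (t ·ᵥ A) , Block.line⊆B Bxy (t ·ᵥ A) (line-·A t t∈) , ·A-involutive t
    B≐BA : B ≐ (B ·ˢ A)
    B≐BA = proj₂ (proj₂ sts (line x y) (line-dim2 x y xy)) B (B ·ˢ A)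
             (Block.B∈𝒟 Bxy) (Block.line⊆B Bxy) (proj₁ aut B (Block.B∈𝒟 Bxy)) line⊆BA

-- Counting configurations

module FixedPointCounting {v : ℕ} (𝒟 : SetOfSub v) (sts : IsSTS 𝒟) (A : Mat v) (A²≡I : A ·ₘ A ≡ idMat)
                          (aut : IsAutomorphism 𝒟 A) where
  open SteinerTripleSystem 𝒟 sts
  open Involution A A²≡I
  open InvolutionOnInvariant3Space A A²≡I

  fixedNonzero : Vecᶠ v → Bool
  fixedNonzero p = isFixed p ∧ nonzero p

  fixedPair : Vecᶠ v → Vecᶠ v → Bool
  fixedPair p q = fixedNonzero p ∧ fixedNonzero q ∧ not (p ==ᵥ q)

  fixedPair⇒independentPair : ∀ p q → fixedPair p q ≡ true → independentPair p q ≡ true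
  fixedPair⇒independentPair p q e = ∧-intro (∧-elimʳ (isFixed p) (∧-elimˡ _ e))
    (∧-intro (∧-elimʳ (isFixed q) (∧-elimˡ _ (∧-elimʳ (fixedNonzero p) e))) (∧-elimʳ (fixedNonzero q) (∧-elimʳ (fixedNonzero p) e)))

  fixedPair-fixedˡ : ∀ p q → fixedPair p q ≡ true → isFixed p ≡ true
  fixedPair-fixedˡ p q e = ∧-elimˡ _ (∧-elimˡ _ e)

  fixedPair-fixedʳ : ∀ p q → fixedPair p q ≡ true → isFixed q ≡ true
  fixedPair-fixedʳ p q e = ∧-elimˡ _ (∧-elimˡ _ (∧-elimʳ (fixedNonzero p) e))

  fixed⇒·A≡ : ∀ p → isFixed p ≡ true → p ·ᵥ A ≡ p
  fixed⇒·A≡ p e = ⊕≡0⇒≡ _ _ (isFixed⇒A+I≡0 p e)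

  isFixed-⊕ : ∀ p q → isFixed p ≡ true → isFixed q ≡ true → isFixed (p ⊕ q) ≡ true
  isFixed-⊕ p q fp fq = A+I≡0⇒isFixed _ (trans (A+I-⊕ p q) (trans (cong₂ _⊕_ (isFixed⇒A+I≡0 p fp) (isFixed⇒A+I≡0 q fq)) (⊕-same zeroV)))

  line-fixed : ∀ p q r → isFixed p ≡ true → isFixed q ≡ true → inSpan (p ∷ q ∷ []) r ≡ true → isFixed r ≡ true
  line-fixed p q r fp fq e = let (c , c·pq≡r) = inSpan⇒·ᵥ (p ∷ q ∷ []) r e in
    A+I≡0⇒isFixed r (trans (cong A+I (sym c·pq≡r))
      (fixed-·ᵥ c (p ∷ q ∷ []) (cong₂ _∷_ (isFixed⇒A+I≡0 p fp) (cong (_∷ []) (isFixed⇒A+I≡0 q fq)))))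

  fixedPair-block-invariant : ∀ p q → fixedPair p q ≡ true → ∀ z → inBlock p q z ≡ true → inBlock p q (z ·ᵥ A) ≡ true
  fixedPair-block-invariant p q e = block-·A-closed A A²≡I aut p q (fixedPair⇒independentPair p q e)
    (subst (λ t → inSpan (p ∷ q ∷ []) t ≡ true) (sym (fixed⇒·A≡ p (fixedPair-fixedˡ p q e))) (nth-inSpan 0 (p ∷ q ∷ [])))
    (subst (λ t → inSpan (p ∷ q ∷ []) t ≡ true) (sym (fixed⇒·A≡ q (fixedPair-fixedʳ p q e))) (nth-inSpan 1 (p ∷ q ∷ [])))

  moved⇒independentPair : ∀ r → isFixed r ≡ false → independentPair r (r ·ᵥ A) ≡ true
  moved⇒independentPair r moved = ∧-intro (nonzero-if r≢0) (∧-intro (nonzero-if rA≢0) (cong not (false-if r≢rA)))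
    where
    fixed-if : r ·ᵥ A ≡ r → ⊥
    fixed-if rA≡r = false≢true (trans (sym moved) (A+I≡0⇒isFixed r (≡⇒⊕≡0 rA≡r)))
    r≢0 : r ≢ zeroV
    r≢0 r≡0 = fixed-if (trans (cong (_·ᵥ A) r≡0) (trans (·ᵥ-zeroˡ A) (sym r≡0)))
    rA≢0 : r ·ᵥ A ≢ zeroV
    rA≢0 rA≡0 = r≢0 (trans (sym (·A-involutive r)) (trans (cong (_·ᵥ A) rA≡0) (·ᵥ-zeroˡ A)))
    r≢rA : r ≢ r ·ᵥ A
    r≢rA r≡rA = fixed-if (sym r≡rA)
    false-if : ∀ {x y : Vecᶠ v} → x ≢ y → x ==ᵥ y ≡ false
    false-if {x} {y} x≢y with x ==ᵥ y in e
    ... | false = refl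
    ... | true = ⊥-elim (x≢y (==ᵥ-sound x y e))
    nonzero-if : ∀ {x : Vecᶠ v} → x ≢ zeroV → nonzero x ≡ true
    nonzero-if x≢0 = cong not (false-if x≢0)

  moved-block-invariant : ∀ r → isFixed r ≡ false → ∀ z → inBlock r (r ·ᵥ A) z ≡ true → inBlock r (r ·ᵥ A) (z ·ᵥ A) ≡ true
  moved-block-invariant r moved = block-·A-closed A A²≡I aut r (r ·ᵥ A) (moved⇒independentPair r moved)
    (nth-inSpan 1 (r ∷ (r ·ᵥ A) ∷ []))
    (subst (λ t → inSpan (r ∷ (r ·ᵥ A) ∷ []) t ≡ true) (sym (·A-involutive r)) (nth-inSpan 0 (r ∷ (r ·ᵥ A) ∷ [])))

  configuration : Vecᶠ v → Vecᶠ v → Vecᶠ v → Bool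
  configuration p q r = fixedPair p q ∧ (inBlock p q r ∧ not (inSpan (p ∷ q ∷ []) r))

  ∑³ : (Vecᶠ v → Vecᶠ v → Vecᶠ v → ℕ) → ℕ
  ∑³ f = ∑ v (λ p → ∑ v (λ q → ∑ v (λ r → f p q r)))

  ∑³-configuration : ∑³ (λ p q r → 𝟙 (configuration p q r))
                   ≡ (Count.count v fixedNonzero * (Count.count v fixedNonzero ∸ 1)) * 4
  ∑³-configuration = begin
    ∑³ (λ p q r → 𝟙 (configuration p q r))           ≡⟨ Count.sum-cong v _ _ (λ p → Count.sum-cong v _ _ (λ q → per-pair p q)) ⟩
    ∑ v (λ p → ∑ v (λ q → 𝟙 (fixedPair p q) * 4))     ≡⟨ Count.sum-cong v _ _ (λ p → Count.sum-*ʳ v 4 (λ q → 𝟙 (fixedPair p q))) ⟩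
    ∑ v (λ p → ∑ v (λ q → 𝟙 (fixedPair p q)) * 4)     ≡⟨ Count.sum-*ʳ v 4 _ ⟩
    ∑ v (λ p → ∑ v (λ q → 𝟙 (fixedPair p q))) * 4     ≡⟨ cong (_* 4) (count-ordered-pairs v fixedNonzero) ⟩
    (Count.count v fixedNonzero * (Count.count v fixedNonzero ∸ 1)) * 4 ∎
    where
    open ≡-Reasoning
    per-pair : ∀ p q → ∑ v (λ r → 𝟙 (configuration p q r)) ≡ 𝟙 (fixedPair p q) * 4
    per-pair p q with fixedPair p q in e
    ... | false = Count.sum-0 v
    ... | true = plane-complement-count (blockBasis p q) (Block.independent (block p q pq)) p q
                   (x∈block p q pq) (y∈block p q pq) pq
      where
      pq = fixedPair⇒independentPair p q e

  inMovedBlock : Vecᶠ v → Vecᶠ v → Bool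
  inMovedBlock r p = isFixed p ∧ nonzero p ∧ inBlock r (r ·ᵥ A) p

  -- The block through a fixed pair is A-invariant, so if it contains r it also contains r A and is
  -- therefore the block through r and r A.
  moved-configuration≡ : ∀ p q r → (configuration p q r ∧ not (isFixed r))
                       ≡ (not (isFixed r) ∧ (inMovedBlock r p ∧ inMovedBlock r q ∧ not (p ==ᵥ q)))
  moved-configuration≡ p q r = ≡true-ext _ _ to from
    where
    to : configuration p q r ∧ not (isFixed r) ≡ true → _
    to e = ∧-intro r-moved′ (∧-intro (inMoved p (∧-elimˡ _ pq) (x∈block p q indep))
                                    (∧-intro (inMoved q (∧-elimˡ _ (∧-elimʳ (fixedNonzero p) pq)) (y∈block p q indep))
                                             (∧-elimʳ (fixedNonzero q) (∧-elimʳ (fixedNonzero p) pq))))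
      where
      conf = ∧-elimˡ (configuration p q r) e
      r-moved′ = ∧-elimʳ (configuration p q r) e
      pq = ∧-elimˡ (fixedPair p q) conf
      indep = fixedPair⇒independentPair p q pq
      r∈ = ∧-elimˡ (inBlock p q r) (∧-elimʳ (fixedPair p q) conf)
      same : ∀ z → inBlock r (r ·ᵥ A) z ≡ inBlock p q z
      same = block-unique p q r (r ·ᵥ A) indep (moved⇒independentPair r (not-true _ r-moved′))
               r∈ (fixedPair-block-invariant p q pq r r∈)
      inMoved : ∀ x → fixedNonzero x ≡ true → inBlock p q x ≡ true → inMovedBlock r x ≡ true
      inMoved x x-fixed x∈ = ∧-intro (∧-elimˡ (isFixed x) x-fixed) (∧-intro (∧-elimʳ (isFixed x) x-fixed) (trans (same x) x∈))
    from : not (isFixed r) ∧ (inMovedBlock r p ∧ inMovedBlock r q ∧ not (p ==ᵥ q)) ≡ true →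
           configuration p q r ∧ not (isFixed r) ≡ true
    from e = ∧-intro (∧-intro pq (∧-intro r∈ (cong not r∉line))) r-moved′
      where
      r-moved′ = ∧-elimˡ (not (isFixed r)) e
      r-moved = not-true _ r-moved′
      rest = ∧-elimʳ (not (isFixed r)) e
      ψp = ∧-elimˡ (inMovedBlock r p) rest
      ψq = ∧-elimˡ (inMovedBlock r q) (∧-elimʳ (inMovedBlock r p) rest)
      p≢q = ∧-elimʳ (inMovedBlock r q) (∧-elimʳ (inMovedBlock r p) rest)
      fp = ∧-elimˡ (isFixed p) ψp
      fq = ∧-elimˡ (isFixed q) ψq
      pq : fixedPair p q ≡ true
      pq = ∧-intro (∧-intro fp (∧-elimˡ (nonzero p) (∧-elimʳ (isFixed p) ψp)))
                   (∧-intro (∧-intro fq (∧-elimˡ (nonzero q) (∧-elimʳ (isFixed q) ψq))) p≢q)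
      rrA = moved⇒independentPair r r-moved
      same : ∀ z → inBlock p q z ≡ inBlock r (r ·ᵥ A) z
      same = block-unique r (r ·ᵥ A) p q rrA (fixedPair⇒independentPair p q pq)
               (∧-elimʳ (nonzero p) (∧-elimʳ (isFixed p) ψp)) (∧-elimʳ (nonzero q) (∧-elimʳ (isFixed q) ψq))
      r∈ : inBlock p q r ≡ true
      r∈ = trans (same r) (x∈block r (r ·ᵥ A) rrA)
      r∉line : inSpan (p ∷ q ∷ []) r ≡ false
      r∉line with inSpan (p ∷ q ∷ []) r in e′
      ... | false = refl
      ... | true = ⊥-elim (false≢true (trans (sym r-moved) (line-fixed p q r fp fq e′)))

  ∑³-moved-configuration : ∑³ (λ p q r → 𝟙 (configuration p q r ∧ not (isFixed r))) ≡ Count.count v (λ r → not (isFixed r)) * 6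
  ∑³-moved-configuration = begin
    ∑³ (λ p q r → 𝟙 (configuration p q r ∧ not (isFixed r)))
      ≡⟨ Count.sum-cong v _ _ (λ p → Count.sum-cong v _ _ (λ q → Count.sum-cong v _ _ (λ r → cong 𝟙 (moved-configuration≡ p q r)))) ⟩
    ∑ v (λ p → ∑ v (λ q → ∑ v (λ r → 𝟙 (G r p q))))
      ≡⟨ Count.sum-cong v _ _ (λ p → Count.sum-swap v (Vecᶠ v) (∑ v) (∑-additive v) (λ q r → 𝟙 (G r p q))) ⟩
    ∑ v (λ p → ∑ v (λ r → ∑ v (λ q → 𝟙 (G r p q))))
      ≡⟨ Count.sum-swap v (Vecᶠ v) (∑ v) (∑-additive v) (λ p r → ∑ v (λ q → 𝟙 (G r p q))) ⟩
    ∑ v (λ r → ∑ v (λ p → ∑ v (λ q → 𝟙 (G r p q))))             ≡⟨ Count.sum-cong v _ _ per-point ⟩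
    ∑ v (λ r → 𝟙 (not (isFixed r)) * 6)                         ≡⟨ Count.sum-*ʳ v 6 _ ⟩
    Count.count v (λ r → not (isFixed r)) * 6 ∎
    where
    open ≡-Reasoning
    G : Vecᶠ v → Vecᶠ v → Vecᶠ v → Bool
    G r p q = not (isFixed r) ∧ (inMovedBlock r p ∧ inMovedBlock r q ∧ not (p ==ᵥ q))
    per-point : ∀ r → ∑ v (λ p → ∑ v (λ q → 𝟙 (G r p q))) ≡ 𝟙 (not (isFixed r)) * 6
    per-point r with isFixed r in fixed
    ... | true = trans (Count.sum-cong v _ _ (λ p → Count.sum-0 v)) (Count.sum-0 v)
    ... | false = trans (count-ordered-pairs v (inMovedBlock r)) (cong (λ k → k * (k ∸ 1)) three)
      where
      rrA = moved⇒independentPair r fixed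
      three : Count.count v (inMovedBlock r) ≡ 3
      three = fixed-count-in-invariant-3space (blockBasis r (r ·ᵥ A)) (Block.independent (block r (r ·ᵥ A) rrA))
                (moved-block-invariant r fixed) r (x∈block r (r ·ᵥ A) rrA) fixed

Triple : ℕ → Set
Triple n = Vecᶠ n × Vecᶠ n × Vecᶠ n

-- Multiplication by a root of x³ + x + 1 in F₈ = F₂[x]/(x³ + x + 1), a field element of order 7.
singer : ∀ {n} → Triple n → Triple n
singer (p , q , r) = q , r , p ⊕ q

inCoordinates : ∀ {n} → Vec (Vecᶠ n) 3 → Triple 3 → Triple n
inCoordinates b (c₁ , c₂ , c₃) = c₁ ·ᵥ b , c₂ ·ᵥ b , c₃ ·ᵥ b

fold-singer-inCoordinates : ∀ {n} (b : Vec (Vecᶠ n) 3) k t → fold (inCoordinates b t) singer k ≡ inCoordinates b (fold t singer k)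
fold-singer-inCoordinates b zero t = refl
fold-singer-inCoordinates b (suc k) t = trans (cong singer (fold-singer-inCoordinates b k t)) (singer-inCoordinates (fold t singer k))
  where
  singer-inCoordinates : ∀ t → singer (inCoordinates b t) ≡ inCoordinates b (singer t)
  singer-inCoordinates (c₁ , c₂ , c₃) = cong (λ z → c₂ ·ᵥ b , c₃ ·ᵥ b , z) (sym (·ᵥ-distribʳ-⊕ c₁ c₂ b))

unit : ℕ → Vecᶠ 3
unit i = tabulate (λ j → toℕ j ≡ᵇ i)

standard : Triple 3
standard = unit 0 , unit 1 , unit 2

inCoordinates-standard : ∀ {n} (p q r : Vecᶠ n) → inCoordinates (p ∷ q ∷ r ∷ []) standard ≡ (p , q , r)
inCoordinates-standard p q r = cong₂ _,_ (unitRow-·ᵥ 0 b) (cong₂ _,_ (unitRow-·ᵥ 1 b) (unitRow-·ᵥ 2 b))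
  where b = p ∷ q ∷ r ∷ []

singer-periodic : ∀ {n} (t : Triple n) → fold t singer 7 ≡ t
singer-periodic (p , q , r) = begin
  fold (p , q , r) singer 7                     ≡⟨ cong (λ t → fold t singer 7) (sym (inCoordinates-standard p q r)) ⟩
  fold (inCoordinates b standard) singer 7      ≡⟨ fold-singer-inCoordinates b 7 standard ⟩
  inCoordinates b (fold standard singer 7)      ≡⟨ inCoordinates-standard p q r ⟩
  (p , q , r) ∎
  where
  open ≡-Reasoning
  b = p ∷ q ∷ r ∷ []

singer-standard-free : ∀ k → 0 < k → k < 7 → proj₁ (fold standard singer k) ==ᵥ unit 0 ≡ false
singer-standard-free 1 _ _ = refl
singer-standard-free 2 _ _ = refl
singer-standard-free 3 _ _ = refl
singer-standard-free 4 _ _ = refl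
singer-standard-free 5 _ _ = refl
singer-standard-free 6 _ _ = refl
singer-standard-free (suc (suc (suc (suc (suc (suc (suc k))))))) _ (s≤s (s≤s (s≤s (s≤s (s≤s (s≤s (s≤s ())))))))

singer-free : ∀ {n} (p q r : Vecᶠ n) → Independent (p ∷ q ∷ r ∷ []) →
              ∀ k → 0 < k → k < 7 → fold (p , q , r) singer k ≢ (p , q , r)
singer-free p q r indep k 0<k k<7 eq =
  false≢true (trans (sym (singer-standard-free k 0<k k<7)) (subst (λ t → t ==ᵥ unit 0 ≡ true) (sym first≡) (==ᵥ-refl (unit 0))))
  where
  b = p ∷ q ∷ r ∷ []
  eq′ : inCoordinates b (fold standard singer k) ≡ inCoordinates b standard
  eq′ = trans (sym (fold-singer-inCoordinates b k standard))
          (trans (cong (λ t → fold t singer k) (inCoordinates-standard p q r)) (trans eq (sym (inCoordinates-standard p q r))))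
  first≡ : proj₁ (fold standard singer k) ≡ unit 0
  first≡ = independent-injective b indep _ _ (cong proj₁ eq′)

module FixedConfigurations {v : ℕ} (𝒟 : SetOfSub v) (sts : IsSTS 𝒟) (A : Mat v) (A²≡I : A ·ₘ A ≡ idMat)
                           (aut : IsAutomorphism 𝒟 A) where
  open SteinerTripleSystem 𝒟 sts
  open Involution A A²≡I
  open FixedPointCounting 𝒟 sts A A²≡I aut

  fixedConfiguration : Triple v → Bool
  fixedConfiguration (p , q , r) = configuration p q r ∧ isFixed r

  configuration-independent : ∀ p q r → configuration p q r ≡ true → Independent (p ∷ q ∷ r ∷ [])
  configuration-independent p q r conf = independent-insert (p ∷ q ∷ []) [] r
    (independentPair⇒Independent p q (fixedPair⇒independentPair p q (∧-elimˡ _ conf)))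
    (not-true _ (∧-elimʳ (inBlock p q r) (∧-elimʳ (fixedPair p q) conf)))

  fixedConfiguration-singer : ∀ t → fixedConfiguration t ≡ true → fixedConfiguration (singer t) ≡ true
  fixedConfiguration-singer (p , q , r) e = ∧-intro (∧-intro qr (∧-intro p⊕q∈ (cong not p⊕q∉))) (isFixed-⊕ p q fp fq)
    where
    conf = ∧-elimˡ (configuration p q r) e
    pq = ∧-elimˡ (fixedPair p q) conf
    indep = fixedPair⇒independentPair p q pq
    r∈ = ∧-elimˡ (inBlock p q r) (∧-elimʳ (fixedPair p q) conf)
    b = p ∷ q ∷ r ∷ []
    indep-b = configuration-independent p q r conf
    fp = fixedPair-fixedˡ p q pq
    fq = fixedPair-fixedʳ p q pq
    qr : fixedPair q r ≡ true
    qr = ∧-intro (∧-intro fq (∧-elimʳ (isFixed q) (∧-elimˡ _ (∧-elimʳ (fixedNonzero p) pq))))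
                 (∧-intro (∧-intro (∧-elimʳ (configuration p q r) e) (trans (cong nonzero (sym (unitRow-·ᵥ 2 b))) (nonzero-coordinates b indep-b (unit 2))))
                          (cong not (trans (cong₂ _==ᵥ_ (sym (unitRow-·ᵥ 1 b)) (sym (unitRow-·ᵥ 2 b))) (==ᵥ-coordinates b indep-b (unit 1) (unit 2)))))
    p⊕q∈ : inBlock q r (p ⊕ q) ≡ true
    p⊕q∈ = trans (block-unique p q q r indep (fixedPair⇒independentPair q r qr) (y∈block p q indep) r∈ (p ⊕ q))
                 (inSpan-⊕ (blockBasis p q) p q (x∈block p q indep) (y∈block p q indep))
    p⊕q∉ : inSpan (q ∷ r ∷ []) (p ⊕ q) ≡ false
    p⊕q∉ = trans (cong₂ inSpan (sym (cong₂ _∷_ (unitRow-·ᵥ 1 b) (cong (_∷ []) (unitRow-·ᵥ 2 b))))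
                               (sym (trans (·ᵥ-distribʳ-⊕ (unit 0) (unit 1) b) (cong₂ _⊕_ (unitRow-·ᵥ 0 b) (unitRow-·ᵥ 1 b)))))
                 (inSpan-coordinates b indep-b (unit 1 ∷ unit 2 ∷ []) (unit 0 ⊕ unit 1))

  triples : FinSet
  triples = vecFinSet v ×ᶠ (vecFinSet v ×ᶠ vecFinSet v)

  open FinSetProperties triples using (module Orbits)
  open Orbits singer 6 singer-periodic

  7∣∑³-fixedConfiguration : 7 ∣ ∑³ (λ p q r → 𝟙 (configuration p q r ∧ isFixed r))
  7∣∑³-fixedConfiguration = period∣count _ fixedConfiguration ≤-refl
    (λ t → fixedConfiguration-singer t)
    (λ { (p , q , r) k e → singer-free p q r (configuration-independent p q r (∧-elimˡ (configuration p q r) e)) k })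

-- Arithmetic modulo 7

infix 4 _≡₇_

record _≡₇_ (a b : ℕ) : Set where
  constructor mod7
  field unmod7 : a % 7 ≡ b % 7
open _≡₇_

≡₇-refl : ∀ {a} → a ≡₇ a
≡₇-refl = mod7 refl

≡₇-sym : ∀ {a b} → a ≡₇ b → b ≡₇ a
≡₇-sym (mod7 p) = mod7 (sym p)

≡₇-trans : ∀ {a b c} → a ≡₇ b → b ≡₇ c → a ≡₇ c
≡₇-trans (mod7 p) (mod7 q) = mod7 (trans p q)

≡₇-+ : ∀ {a b c d} → a ≡₇ b → c ≡₇ d → a + c ≡₇ b + d
≡₇-+ {a} {b} {c} {d} (mod7 p) (mod7 q) =
  mod7 (trans (%-distribˡ-+ a c 7) (trans (cong₂ (λ x y → (x + y) % 7) p q) (sym (%-distribˡ-+ b d 7))))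

≡₇-* : ∀ {a b c d} → a ≡₇ b → c ≡₇ d → a * c ≡₇ b * d
≡₇-* {a} {b} {c} {d} (mod7 p) (mod7 q) =
  mod7 (trans (%-distribˡ-* a c 7) (trans (cong₂ (λ x y → (x * y) % 7) p q) (sym (%-distribˡ-* b d 7))))

≡₇-% : ∀ a → a ≡₇ a % 7
≡₇-% a = mod7 (sym (m%n%n≡m%n a 7))

2^-mod7 : ∀ n → 2 ^ n ≡₇ 2 ^ (n % 3)
2^-mod7 0 = ≡₇-refl
2^-mod7 1 = ≡₇-refl
2^-mod7 2 = ≡₇-refl
2^-mod7 (suc (suc (suc n))) = mod7 (begin
  (2 * (2 * (2 * 2 ^ n))) % 7   ≡⟨ cong (_% 7) (8x≡x+7x (2 ^ n)) ⟩
  (2 ^ n + 2 ^ n * 7) % 7       ≡⟨ [m+kn]%n≡m%n (2 ^ n) (2 ^ n) 7 ⟩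
  2 ^ n % 7                     ≡⟨ unmod7 (2^-mod7 n) ⟩
  2 ^ (n % 3) % 7               ≡⟨ cong (λ t → 2 ^ t % 7) (sym (trans (cong (_% 3) (+-comm 3 n)) ([m+n]%n≡m%n n 3))) ⟩
  2 ^ (suc (suc (suc n)) % 3) % 7 ∎)
  where
  open ≡-Reasoning
  8x≡x+7x : ∀ x → 2 * (2 * (2 * x)) ≡ x + x * 7
  8x≡x+7x = solve-∀

AdmissibleResidues : ℕ → ℕ → Set
AdmissibleResidues a b = (a ≡ 0 × b ≢ 2) ⊎ (a ≡ 1 × b ≡ 2)

-- r is the residue of j = F − 2 modulo 7 when the number F of fixed vectors is ≡ 2 ^ b (mod 7).
admissible-residues : ∀ a b → a < 3 → b < 3 →
  let r = (2 ^ b + 5) % 7 in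
  6 * ((r + 2) * 2 ^ a) ≡₇ 4 * ((r + 1) * r) + 6 * (r + 2) →
  AdmissibleResidues a b
admissible-residues 0 0 _ _ _ = inj₁ (refl , λ ())
admissible-residues 0 1 _ _ _ = inj₁ (refl , λ ())
admissible-residues 0 2 _ _ (mod7 ())
admissible-residues 1 0 _ _ (mod7 ())
admissible-residues 1 1 _ _ (mod7 ())
admissible-residues 1 2 _ _ _ = inj₂ (refl , refl)
admissible-residues 2 0 _ _ (mod7 ())
admissible-residues 2 1 _ _ (mod7 ())
admissible-residues 2 2 _ _ (mod7 ())
admissible-residues (suc (suc (suc a))) b (s≤s (s≤s (s≤s ()))) _
admissible-residues a (suc (suc (suc b))) _ (s≤s (s≤s (s≤s ())))

exponent-residues : ∀ e j s f → 7 ∣ e → e + 6 * ((j + 2) * 2 ^ s) ≡ 4 * ((j + 1) * j) + 6 * (j + 2) → j + 2 ≡ 2 ^ f →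
                    AdmissibleResidues (s % 3) (f % 3)
exponent-residues e j s f 7∣e eq j+2≡2^f = admissible-residues (s % 3) (f % 3) (m%n<n s 3) (m%n<n f 3) reduced
  where
  r = (2 ^ (f % 3) + 5) % 7
  j≡r : j ≡₇ r
  j≡r = ≡₇-trans (mod7 (begin
    j % 7                       ≡⟨ sym ([m+n]%n≡m%n j 7) ⟩
    (j + 7) % 7                 ≡⟨ cong (_% 7) (sym (+-assoc j 2 5)) ⟩
    ((j + 2) + 5) % 7           ≡⟨ cong (λ t → (t + 5) % 7) j+2≡2^f ⟩
    (2 ^ f + 5) % 7 ∎)) (≡₇-trans (≡₇-+ (2^-mod7 f) ≡₇-refl) (≡₇-% _))
    where open ≡-Reasoning
  equation : 6 * ((j + 2) * 2 ^ s) ≡₇ 4 * ((j + 1) * j) + 6 * (j + 2)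
  equation = mod7 (trans (sym (%-remove-+ˡ (6 * ((j + 2) * 2 ^ s)) 7∣e)) (cong (_% 7) eq))
  reduced : 6 * ((r + 2) * 2 ^ (s % 3)) ≡₇ 4 * ((r + 1) * r) + 6 * (r + 2)
  reduced = ≡₇-trans (≡₇-sym (≡₇-* (≡₇-refl {6}) (≡₇-* (≡₇-+ j≡r ≡₇-refl) (2^-mod7 s))))
              (≡₇-trans equation (≡₇-+ (≡₇-* (≡₇-refl {4}) (≡₇-* (≡₇-+ j≡r ≡₇-refl) j≡r))
                                       (≡₇-* (≡₇-refl {6}) (≡₇-+ j≡r ≡₇-refl))))

module CountingIdentity {v : ℕ} (𝒟 : SetOfSub v) (sts : IsSTS 𝒟) (A : Mat v) (A²≡I : A ·ₘ A ≡ idMat)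
                        (aut : IsAutomorphism 𝒟 A) (s f : ℕ) (1≤f : 1 ≤ f) (v≡s+f : v ≡ s + f)
                        (count-fixed : Count.count v (Involution.isFixed A A²≡I) ≡ 2 ^ f) where
  open Involution A A²≡I
  open FixedPointCounting 𝒟 sts A A²≡I aut
  open FixedConfigurations 𝒟 sts A A²≡I aut

  j : ℕ
  j = 2 ^ f ∸ 2

  j+2≡2^f : j + 2 ≡ 2 ^ f
  j+2≡2^f = m∸n+n≡m (2≤2^f 1≤f)
    where
    2≤2^f : ∀ {f} → 1 ≤ f → 2 ≤ 2 ^ f
    2≤2^f {suc f} _ = *-monoʳ-≤ 2 (m^n>0 2 f)

  count-fixedNonzero : Count.count v fixedNonzero ≡ j + 1
  count-fixedNonzero = +-cancelˡ-≡ 1 _ _ (begin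
    1 + Count.count v fixedNonzero                                     ≡⟨ cong (_+ Count.count v fixedNonzero) (sym zero-fixed) ⟩
    Count.count v (λ x → isFixed x ∧ (x ==ᵥ zeroV)) + Count.count v fixedNonzero ≡⟨ sym (Count.count-split v isFixed (_==ᵥ zeroV)) ⟩
    Count.count v isFixed                                              ≡⟨ count-fixed ⟩
    2 ^ f                                                             ≡⟨ sym j+2≡2^f ⟩
    j + 2                                                             ≡⟨ +-comm j 2 ⟩
    2 + j                                                             ≡⟨ cong suc (+-comm 1 j) ⟩
    1 + (j + 1) ∎)
    where
    open ≡-Reasoning
    isFixed∧=0 : ∀ x → (isFixed x ∧ (x ==ᵥ zeroV)) ≡ (x ==ᵥ zeroV)
    isFixed∧=0 x with x ==ᵥ zeroV in e
    ... | false = ∧-zeroʳ _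
    ... | true = cong (_∧ true) (trans (cong isFixed (==ᵥ-sound x zeroV e)) (A+I≡0⇒isFixed zeroV A+I-zeroV))
    zero-fixed : Count.count v (λ x → isFixed x ∧ (x ==ᵥ zeroV)) ≡ 1
    zero-fixed = trans (Count.count-cong v _ _ isFixed∧=0) (Count.count-singleton v zeroV)

  count-moved : Count.count v (λ r → not (isFixed r)) + 2 ^ f ≡ 2 ^ v
  count-moved = begin
    Count.count v (λ r → not (isFixed r)) + 2 ^ f               ≡⟨ +-comm _ (2 ^ f) ⟩
    2 ^ f + Count.count v (λ r → not (isFixed r))               ≡⟨ cong (_+ _) (sym count-fixed) ⟩
    Count.count v isFixed + Count.count v (λ r → not (isFixed r)) ≡⟨ sym (Count.count-split v (λ _ → true) isFixed) ⟩
    ∑ v (λ _ → 1)                                              ≡⟨ ∑-const-1 v ⟩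
    2 ^ v ∎
    where open ≡-Reasoning

  E : ℕ
  E = ∑³ (λ p q r → 𝟙 (configuration p q r ∧ isFixed r))

  configurations-by-r : E + Count.count v (λ r → not (isFixed r)) * 6 ≡ ((j + 1) * j) * 4
  configurations-by-r = begin
    E + Count.count v (λ r → not (isFixed r)) * 6                          ≡⟨ cong (E +_) (sym ∑³-moved-configuration) ⟩
    E + ∑³ (λ p q r → 𝟙 (configuration p q r ∧ not (isFixed r)))            ≡⟨ sym split ⟩
    ∑³ (λ p q r → 𝟙 (configuration p q r))                                ≡⟨ ∑³-configuration ⟩
    (Count.count v fixedNonzero * (Count.count v fixedNonzero ∸ 1)) * 4   ≡⟨ cong (λ k → (k * (k ∸ 1)) * 4) count-fixedNonzero ⟩
    ((j + 1) * (j + 1 ∸ 1)) * 4                                           ≡⟨ cong (λ t → ((j + 1) * t) * 4) (m+n∸n≡m j 1) ⟩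
    ((j + 1) * j) * 4 ∎
    where
    open ≡-Reasoning
    split : ∑³ (λ p q r → 𝟙 (configuration p q r))
          ≡ E + ∑³ (λ p q r → 𝟙 (configuration p q r ∧ not (isFixed r)))
    split = trans (FinSet.sum-cong triples _ _ (λ { (p , q , r) → 𝟙-split (configuration p q r) (isFixed r) }))
                  (FinSet.sum-+ triples _ _)

  counting-identity : E + 6 * ((j + 2) * 2 ^ s) ≡ 4 * ((j + 1) * j) + 6 * (j + 2)
  counting-identity = begin
    E + 6 * ((j + 2) * 2 ^ s)                ≡⟨ cong (λ t → E + 6 * t) (sym moved+fixed) ⟩
    E + 6 * (H + (j + 2))                    ≡⟨ rearrange E H j ⟩
    (E + H * 6) + 6 * (j + 2)                ≡⟨ cong (_+ 6 * (j + 2)) configurations-by-r ⟩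
    ((j + 1) * j) * 4 + 6 * (j + 2)          ≡⟨ cong (_+ 6 * (j + 2)) (*-comm ((j + 1) * j) 4) ⟩
    4 * ((j + 1) * j) + 6 * (j + 2) ∎
    where
    open ≡-Reasoning
    H = Count.count v (λ r → not (isFixed r))
    moved+fixed : H + (j + 2) ≡ (j + 2) * 2 ^ s
    moved+fixed = trans (cong (H +_) j+2≡2^f) (trans count-moved (trans (cong (2 ^_) (trans v≡s+f (+-comm s f)))
                    (trans (^-distribˡ-+-* 2 f s) (cong (_* 2 ^ s) (sym j+2≡2^f)))))
    rearrange : ∀ e h j → e + 6 * (h + (j + 2)) ≡ (e + h * 6) + 6 * (j + 2)
    rearrange = solve-∀

  exponent-residues-of-involution : AdmissibleResidues (s % 3) (f % 3)
  exponent-residues-of-involution = exponent-residues E j s f 7∣∑³-fixedConfiguration counting-identity j+2≡2^f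

double+m≡s+[s+m] : ∀ s m → double s + m ≡ s + (s + m)
double+m≡s+[s+m] s m = trans (cong (_+ m) (double≡2* s)) (2s+m s m)
  where
  2s+m : ∀ s m → 2 * s + m ≡ s + (s + m)
  2s+m = solve-∀

s≤v/2 : ∀ {v} s m → double s + m ≡ v → s ≤ v / 2
s≤v/2 {v} s m dim = subst (_≤ v / 2) (m*n/n≡m s 2) (/-mono-≤ {o = 2} {p = 2} s*2≤v ≤-refl)
  where
  s*2≤v : s * 2 ≤ v
  s*2≤v = subst₂ _≤_ (trans (double≡2* s) (*-comm 2 s)) dim (m≤m+n (double s) m)

admissible⇒≢2 : ∀ {a b} → AdmissibleResidues a b → a ≢ 2
admissible⇒≢2 (inj₁ (refl , _)) ()
admissible⇒≢2 (inj₂ (refl , _)) ()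

admissible⇒3∣s : ∀ {v s f} → v ≡ s + f → v % 6 ≡ 1 → AdmissibleResidues (s % 3) (f % 3) → 3 ∣ s
admissible⇒3∣s _ _ (inj₁ (s≡0 , _)) = m%n≡0⇒n∣m _ 3 s≡0
admissible⇒3∣s {v} {s} {f} v≡s+f v≡1 (inj₂ (s≡1 , f≡2)) = ⊥-elim (0≢1+n (trans (sym v%3≡0) v%3≡1))
  where
  v%3≡1 : v % 3 ≡ 1
  v%3≡1 = trans (sym (m∣n⇒o%n%m≡o%m 3 6 v (divides 2 refl))) (cong (_% 3) v≡1)
  v%3≡0 : v % 3 ≡ 0
  v%3≡0 = trans (cong (_% 3) v≡s+f) (trans (%-distribˡ-+ s f 3) (cong₂ (λ a b → (a + b) % 3) s≡1 f≡2))

ConjugateToAvs : ∀ {v} → Mat v → (ℕ → Set) → Set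
ConjugateToAvs {v} A P = Σ ℕ λ s → (1 ≤ s) × (s ≤ v / 2) × P s × Conjugate A (Avs v s)

involution-conjugacy-class : ∀ {v} (𝒟 : SetOfSub v) → IsSTS 𝒟 → (A : Mat v) (A²≡I : A ·ₘ A ≡ idMat) → IsAutomorphism 𝒟 A →
  NormalForm A A²≡I → (v % 6 ≡ 1 → ConjugateToAvs A (3 ∣_)) × (v % 6 ≡ 3 → ConjugateToAvs A (λ s → s % 3 ≢ 2))
involution-conjugacy-class {v} 𝒟 sts A A²≡I aut (s , m , dim , 1≤s , conjugate , count-fixed) =
  (λ v≡1 → s , 1≤s , s≤v/2 s m dim , admissible⇒3∣s v≡s+f v≡1 residues , conjugate) ,
  (λ _ → s , 1≤s , s≤v/2 s m dim , admissible⇒≢2 residues , conjugate)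
  where
  v≡s+f : v ≡ s + (s + m)
  v≡s+f = trans (sym dim) (double+m≡s+[s+m] s m)
  residues = CountingIdentity.exponent-residues-of-involution 𝒟 sts A A²≡I aut s (s + m)
               (≤-trans 1≤s (m≤m+n s m)) v≡s+f count-fixed

theorem2 : (v : ℕ) → 1 ≤ v → (𝒟 : SetOfSub v) → IsSTS 𝒟 →
           (A : Mat v) → Invertible A → IsAutomorphism 𝒟 A → HasOrder2 A →
           (v % 6 ≡ 1 →
             Σ ℕ λ s → (1 ≤ s) × (s ≤ v / 2) × (3 ∣ s) × Conjugate A (Avs v s)) ×
           (v % 6 ≡ 3 →
             Σ ℕ λ s → (1 ≤ s) × (s ≤ v / 2) × (s % 3 ≢ 2) × Conjugate A (Avs v s))
theorem2 v _ 𝒟 sts A _ aut (A²≡I , A≢I) =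
  involution-conjugacy-class 𝒟 sts A A²≡I aut (involution-normalForm A A²≡I A≢I)
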